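{- Let $a_j,b_j\in\mathbb{N}_0$ and $c_j\in\mathbb{Z}$ with $c_j\ge3$ for all $j\ge0$ (resp. $j\ge1$). Then for every $n\in\mathbb{N}$: (i) If $r\ge1$ and $\mathbf{s}=(\{2\}^{b_1},c_1,\{2\}^{a_1},1,\dots,\{2\}^{b_r},c_r,\{2\}^{a_r},1)$, then \[H^\star_n(\mathbf{s})=\sum_{\mathbf{p}\in\Pi(\overline{2b_1+2},\{1\}^{c_1-3},\overline{2a_1+2},\,\dots,\,\overline{2b_r+2},\{1\}^{c_r-3},\overline{2a_r+2})}2^{\ell(\mathbf{p})}\mathcal{H}_n(\mathbf{p}).\] (ii) If $r\ge0$ and $\mathbf{s}=(\{2\}^{a_0},1,\{2\}^{b_1},c_1,\{2\}^{a_1},1,\dots,\{2\}^{b_r},c_r,\{2\}^{a_r},1)$, then \[H^\star_n(\mathbf{s})=\sum_{\mathbf{p}\in\Pi(2a_0+1,\overline{2b_1+2},\{1\}^{c_1-3},\overline{2a_1+2},\,\dots,\,\overline{2b_r+2},\{1\}^{c_r-3},\overline{2a_r+2})}2^{\ell(\mathbf{p})}\mathcal{H}_n(\mathbf{p}).\]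
   Context: $\mathbb{N}=\{1,2,\dots\}$, $\mathbb{N}_0=\mathbb{N}\cup\{0\}$; for a positive integer $m$, $\overline{m}$ denotes $-m$. $\{x\}^a$ denotes $a$ consecutive copies of $x$ (empty if $a=0$). For $\mathbf{s}=(s_1,\dots,s_\ell)$ with nonzero integer entries, $H_n(\mathbf{s})=\sum_{n\ge k_1>\cdots>k_\ell\ge1}\prod_{i=1}^\ell \frac{\operatorname{sgn}(s_i)^{k_i}}{k_i^{|s_i|}}$ and $H^\star_n(\mathbf{s})=\sum_{n\ge k_1\ge\cdots\ge k_\ell\ge1}\prod_{i=1}^\ell \frac{\operatorname{sgn}(s_i)^{k_i}}{k_i^{|s_i|}}$, with $H_n(\mathbf{s})=0$ if $n<\ell$ and $H_n(\emptyset)=H^\star_n(\emptyset)=1$. For nonzero integers $a,b$, $a\oplus b=\operatorname{sgn}(a)b+\operatorname{sgn}(b)a$. For a sequence $(s_1,\dots,s_m)$ of nonzero integers, $\Pi(s_1,\dots,s_m)$ is the set of the $2^{m-1}$ indices $s_1\circ\cdots\circ s_m$ where each $\circ$ is independently either "," or $\oplus$ (entries joined by $\oplus$ merge into one component); $\ell(\mathbf{p})$ is the number of components. For $\mathbf{p}=(p_1,\dots,p_m)$, $\mathcal{H}_n(\mathbf{p})=\sum_{k=1}^n\frac{\operatorname{sgn}(p_1)^k}{k^{|p_1|}}\frac{\binom{n}{k}}{\binom{n+k}{k}}H_{k-1}(p_2,\dots,p_m)$. -}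

module Defs where

open import Data.Nat as ℕ using (ℕ; zero; suc; _∸_; _^_)
open import Data.Nat.Combinatorics using (_C_)
open import Data.Integer as ℤ using (ℤ; +_; -[1+_])
open import Data.Rational using (ℚ; 0ℚ; 1ℚ; _+_; _*_; -_; _/_)
open import Data.List using (List; []; _∷_; _++_; map; foldr; replicate; length)

sumℚ : List ℚ → ℚ
sumℚ = foldr _+_ 0ℚ

sumTo : ℕ → (ℕ → ℚ) → ℚ
sumTo zero    f = 0ℚ
sumTo (suc n) f = sumTo n f + f (suc n)

-- a / b as a rational (only ever used with b ≥ 1; the b = 0 clause is a dummy)
ratio : ℕ → ℕ → ℚ
ratio a zero    = 0ℚ
ratio a (suc b) = (+ a) / suc b

sgnPow : ℤ → ℕ → ℚ
sgnPow (+ _)    k       = 1ℚ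
sgnPow -[1+ _ ] zero    = 1ℚ
sgnPow -[1+ m ] (suc k) = - sgnPow -[1+ m ] k

term : ℕ → ℤ → ℚ
term k s = sgnPow s k * ratio 1 (k ^ ℤ.∣ s ∣)

-- H_n(s) : strict nested harmonic sum, n ≥ k₁ > k₂ > ⋯ > k_ℓ ≥ 1
H : ℕ → List ℤ → ℚ
H n []       = 1ℚ
H n (s ∷ ss) = sumTo n (λ k → term k s * H (k ∸ 1) ss)

-- H⋆_n(s) : non-strict nested harmonic sum, n ≥ k₁ ≥ k₂ ≥ ⋯ ≥ k_ℓ ≥ 1
H⋆ : ℕ → List ℤ → ℚ
H⋆ n []       = 1ℚ
H⋆ n (s ∷ ss) = sumTo n (λ k → term k s * H⋆ k ss)

sgnℤ : ℤ → ℤ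
sgnℤ (+ zero)  = + 0
sgnℤ (+ suc _) = + 1
sgnℤ -[1+ _ ]  = -[1+ 0 ]

_⊕_ : ℤ → ℤ → ℤ
a ⊕ b = sgnℤ a ℤ.* b ℤ.+ sgnℤ b ℤ.* a

-- Π(s₁,…,s_m): all 2^{m-1} indices s₁ ∘ ⋯ ∘ s_m, ∘ ∈ {",", ⊕}
-- (acc is the current component being built, merged left to right)
Πgo : ℤ → List ℤ → List (List ℤ)
Πgo acc []       = (acc ∷ []) ∷ []
Πgo acc (y ∷ ys) = map (acc ∷_) (Πgo y ys) ++ Πgo (acc ⊕ y) ys

Π : List ℤ → List (List ℤ)
Π []       = [] ∷ []
Π (x ∷ xs) = Πgo x xs

-- 𝓗_n(p₁,…,p_m) = Σ_{k=1}^n sgn(p₁)^k/k^{|p₁|} · C(n,k)/C(n+k,k) · H_{k-1}(p₂,…,p_m)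
-- (only used for nonempty p; the [] clause is a dummy)
𝓗 : ℕ → List ℤ → ℚ
𝓗 n []       = 0ℚ
𝓗 n (p ∷ ps) =
  sumTo n (λ k → term k p * ratio (n C k) ((n ℕ.+ k) C k) * H (k ∸ 1) ps)

RHS : ℕ → List ℤ → ℚ
RHS n t = sumℚ (map (λ p → ratio (2 ^ length p) 1 * 𝓗 n p) (Π t))

concatUpTo : (ℕ → List ℤ) → ℕ → List ℤ
concatUpTo f zero    = []
concatUpTo f (suc r) = concatUpTo f r ++ f (suc r)

sBlock : (a b c : ℕ → ℕ) → ℕ → List ℤ
sBlock a b c j =
  replicate (b j) (+ 2) ++ (+ c j) ∷ replicate (a j) (+ 2) ++ (+ 1) ∷ []

pBlock : (a b c : ℕ → ℕ) → ℕ → List ℤ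
pBlock a b c j =
  ℤ.- (+ (2 ℕ.* b j ℕ.+ 2)) ∷ replicate (c j ∸ 3) (+ 1) ++ ℤ.- (+ (2 ℕ.* a j ℕ.+ 2)) ∷ []

{-# OPTIONS --safe #-}
-- Put w n k = C(n,k)/C(n+k,k) and Φ_n(V) = Σ_{k≤n} w n k (V_k - V_{k-1}). Then 𝓗_n(p) = Φ_n(H_•(p)),
-- so the right-hand side is Φ_n(U) with U_k = Σ_{p∈Π(t)} 2^{ℓ(p)} H_k(p). The index s is built from
-- the right, using H⋆_n(x, s) = Σ_{m≤n} m^{-x} H⋆_m(s). Since w m k - w (m-1) k = (k/m)² w m k, a sum
-- Σ_{m≤n} m^{-x} Φ_m(V) can be re-summed by levels into Φ_n of an explicit sequence, and telescoping
-- identifies that sequence with the U of an enlarged t: prefixing 1 to s prefixes 1 to t, prefixing 2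
-- replaces the first entry x of t by 2 ⊕ x, and prefixing c = m + 3 turns t = (y, T) into
-- (‾2, {1}^m, ‾1 ⊕ y, T). Reading s from the right, block by block, gives both parts.
module Submission where

open import Defs

module RationalSums where

  open import Data.Nat as ℕ using (ℕ; zero; suc)
  import Data.Nat.Properties as ℕₚ
  open import Data.Integer as ℤ using (+_)
  import Data.Integer.Properties as ℤₚ
  open import Data.Rational using (ℚ; 0ℚ; 1ℚ; _+_; _*_; _-_; _/_; toℚᵘ)
  import Data.Rational.Properties as ℚₚ
  import Data.Rational.Unnormalised as ℚᵘ
  import Data.Rational.Unnormalised.Properties as ℚᵘₚ
  open import Data.List using (List; []; _∷_; _++_; map)
  open import Data.Maybe using (Maybe; just; nothing)
  open import Relation.Nullary using (yes; no)
  open import Relation.Binary.PropositionalEquality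
  open import Tactic.RingSolver using (solve-∀)
  open import Tactic.RingSolver.Core.AlmostCommutativeRing using (AlmostCommutativeRing; fromCommutativeRing)

  ℚ-ring : AlmostCommutativeRing _ _
  ℚ-ring = fromCommutativeRing ℚₚ.+-*-commutativeRing isZero?
    where
    isZero? : ∀ x → Maybe (0ℚ ≡ x)
    isZero? x with 0ℚ ℚₚ.≟ x
    ... | yes p = just p
    ... | no _  = nothing

  ⟦_⟧ : ℕ → ℚ
  ⟦ n ⟧ = (+ n) / 1

  private
    ⟦⟧≃ : ∀ n → toℚᵘ ⟦ n ⟧ ℚᵘ.≃ ℚᵘ.mkℚᵘ (+ n) 0
    ⟦⟧≃ n = ℚₚ.toℚᵘ-fromℚᵘ (ℚᵘ.mkℚᵘ (+ n) 0)

  ⟦+⟧ : ∀ m n → ⟦ m ℕ.+ n ⟧ ≡ ⟦ m ⟧ + ⟦ n ⟧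
  ⟦+⟧ m n = ℚₚ.toℚᵘ-injective (ℚᵘₚ.≃-trans (⟦⟧≃ (m ℕ.+ n))
    (ℚᵘₚ.≃-trans {j = ℚᵘ.mkℚᵘ (+ m) 0 ℚᵘ.+ ℚᵘ.mkℚᵘ (+ n) 0} (ℚᵘ.*≡* (cong (ℤ._* + 1) num))
      (ℚᵘₚ.≃-sym (ℚᵘₚ.≃-trans (ℚₚ.toℚᵘ-homo-+ ⟦ m ⟧ ⟦ n ⟧) (ℚᵘₚ.+-cong (⟦⟧≃ m) (⟦⟧≃ n))))))
    where
    num : + (m ℕ.+ n) ≡ + m ℤ.* + 1 ℤ.+ + n ℤ.* + 1
    num = trans (ℤₚ.pos-+ m n) (sym (cong₂ ℤ._+_ (ℤₚ.*-identityʳ (+ m)) (ℤₚ.*-identityʳ (+ n))))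

  ⟦*⟧ : ∀ m n → ⟦ m ℕ.* n ⟧ ≡ ⟦ m ⟧ * ⟦ n ⟧
  ⟦*⟧ m n = ℚₚ.toℚᵘ-injective (ℚᵘₚ.≃-trans (⟦⟧≃ (m ℕ.* n))
    (ℚᵘₚ.≃-trans {j = ℚᵘ.mkℚᵘ (+ m) 0 ℚᵘ.* ℚᵘ.mkℚᵘ (+ n) 0} (ℚᵘ.*≡* (cong (ℤ._* + 1) (ℤₚ.pos-* m n)))
      (ℚᵘₚ.≃-sym (ℚᵘₚ.≃-trans (ℚₚ.toℚᵘ-homo-* ⟦ m ⟧ ⟦ n ⟧) (ℚᵘₚ.*-cong (⟦⟧≃ m) (⟦⟧≃ n))))))

  ⟦suc⟧ : ∀ n → ⟦ suc n ⟧ ≡ ⟦ n ⟧ + 1ℚ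
  ⟦suc⟧ n = trans (⟦+⟧ 1 n) (ℚₚ.+-comm 1ℚ ⟦ n ⟧)

  ratio-*-denominator : ∀ a b → ratio a (suc b) * ⟦ suc b ⟧ ≡ ⟦ a ⟧
  ratio-*-denominator a b = ℚₚ.toℚᵘ-injective
    (ℚᵘₚ.≃-trans (ℚₚ.toℚᵘ-homo-* (ratio a (suc b)) ⟦ suc b ⟧)
    (ℚᵘₚ.≃-trans (ℚᵘₚ.*-cong (ℚₚ.toℚᵘ-fromℚᵘ (ℚᵘ.mkℚᵘ (+ a) b)) (⟦⟧≃ (suc b)))
    (ℚᵘₚ.≃-trans {j = ℚᵘ.mkℚᵘ (+ a) 0} (ℚᵘ.*≡* cross) (ℚᵘₚ.≃-sym (⟦⟧≃ a)))))
    where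
    cross : (+ a ℤ.* + suc b) ℤ.* + 1 ≡ + a ℤ.* + (suc b ℕ.* 1)
    cross = trans (ℤₚ.*-identityʳ _) (cong (λ x → + a ℤ.* + x) (sym (ℕₚ.*-identityʳ (suc b))))

  1/ℕ : ℕ → ℚ
  1/ℕ = ratio 1

  1/ℕ-inverseˡ : ∀ b → 1/ℕ (suc b) * ⟦ suc b ⟧ ≡ 1ℚ
  1/ℕ-inverseˡ = ratio-*-denominator 1

  1/ℕ-inverseʳ : ∀ b → ⟦ suc b ⟧ * 1/ℕ (suc b) ≡ 1ℚ
  1/ℕ-inverseʳ b = trans (ℚₚ.*-comm ⟦ suc b ⟧ (1/ℕ (suc b))) (1/ℕ-inverseˡ b)

  *-identityˡ-≡1 : ∀ {a} x → a ≡ 1ℚ → a * x ≡ x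
  *-identityˡ-≡1 x refl = ℚₚ.*-identityˡ x

  *-inverse-cancelʳ : ∀ x {c i} → c * i ≡ 1ℚ → x * c * i ≡ x
  *-inverse-cancelʳ x {c} {i} ci≡1 =
    trans (ℚₚ.*-assoc x c i) (trans (cong (x *_) ci≡1) (ℚₚ.*-identityʳ x))

  *-cancelʳ-invertible : ∀ {x y} q i → q * i ≡ 1ℚ → x * q ≡ y * q → x ≡ y
  *-cancelʳ-invertible {x} {y} q i qi≡1 xq≡yq = begin
    x          ≡⟨ sym (*-inverse-cancelʳ x qi≡1) ⟩
    x * q * i  ≡⟨ cong (_* i) xq≡yq ⟩
    y * q * i  ≡⟨ *-inverse-cancelʳ y qi≡1 ⟩
    y          ∎
    where open ≡-Reasoning

  1/ℕ-* : ∀ a b → 1/ℕ (a ℕ.* b) ≡ 1/ℕ a * 1/ℕ b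
  1/ℕ-* zero b = sym (ℚₚ.*-zeroˡ (1/ℕ b))
  1/ℕ-* (suc a) zero rewrite ℕₚ.*-zeroʳ a = sym (ℚₚ.*-zeroʳ (1/ℕ (suc a)))
  1/ℕ-* (suc a) (suc b) = *-cancelʳ-invertible ⟦ suc a ℕ.* suc b ⟧ (1/ℕ (suc a ℕ.* suc b))
    (1/ℕ-inverseʳ (b ℕ.+ a ℕ.* suc b))
    (begin
      1/ℕ (suc a ℕ.* suc b) * ⟦ suc a ℕ.* suc b ⟧        ≡⟨ 1/ℕ-inverseˡ (b ℕ.+ a ℕ.* suc b) ⟩
      1ℚ                                                  ≡⟨ sym (cong₂ _*_ (1/ℕ-inverseˡ a) (1/ℕ-inverseˡ b)) ⟩
      (1/ℕ (suc a) * ⟦ suc a ⟧) * (1/ℕ (suc b) * ⟦ suc b ⟧) ≡⟨ interchange (1/ℕ (suc a)) (1/ℕ (suc b)) ⟦ suc a ⟧ ⟦ suc b ⟧ ⟩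
      1/ℕ (suc a) * 1/ℕ (suc b) * (⟦ suc a ⟧ * ⟦ suc b ⟧) ≡⟨ cong (1/ℕ (suc a) * 1/ℕ (suc b) *_) (sym (⟦*⟧ (suc a) (suc b))) ⟩
      1/ℕ (suc a) * 1/ℕ (suc b) * ⟦ suc a ℕ.* suc b ⟧     ∎)
    where
    open ≡-Reasoning
    interchange : ∀ p q r s → (p * r) * (q * s) ≡ p * q * (r * s)
    interchange = solve-∀ ℚ-ring

  sumTo-cong : ∀ n {f g : ℕ → ℚ} → (∀ k → f (suc k) ≡ g (suc k)) → sumTo n f ≡ sumTo n g
  sumTo-cong zero    f≗g = refl
  sumTo-cong (suc n) f≗g = cong₂ _+_ (sumTo-cong n f≗g) (f≗g n)

  sumTo-0 : ∀ n → sumTo n (λ _ → 0ℚ) ≡ 0ℚ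
  sumTo-0 zero    = refl
  sumTo-0 (suc n) = trans (ℚₚ.+-identityʳ _) (sumTo-0 n)

  sumTo-+ : ∀ n (f g : ℕ → ℚ) → sumTo n (λ k → f k + g k) ≡ sumTo n f + sumTo n g
  sumTo-+ zero    f g = refl
  sumTo-+ (suc n) f g = trans (cong (_+ (f (suc n) + g (suc n))) (sumTo-+ n f g))
    (+-interchange (sumTo n f) (sumTo n g) (f (suc n)) (g (suc n)))
    where
    +-interchange : ∀ a b c d → (a + b) + (c + d) ≡ (a + c) + (b + d)
    +-interchange = solve-∀ ℚ-ring

  sumTo-*ˡ : ∀ n c (f : ℕ → ℚ) → sumTo n (λ k → c * f k) ≡ c * sumTo n f
  sumTo-*ˡ zero    c f = sym (ℚₚ.*-zeroʳ c)
  sumTo-*ˡ (suc n) c f = trans (cong (_+ (c * f (suc n))) (sumTo-*ˡ n c f))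
    (sym (ℚₚ.*-distribˡ-+ c (sumTo n f) (f (suc n))))

  sumTo-suc-∸ : ∀ (f : ℕ → ℚ) k → sumTo (suc k) f - sumTo k f ≡ f (suc k)
  sumTo-suc-∸ f k = +-∸ˡ (sumTo k f) (f (suc k))
    where
    +-∸ˡ : ∀ a b → (a + b) - a ≡ b
    +-∸ˡ = solve-∀ ℚ-ring

  sumℚ-map-++ : ∀ {A : Set} (f : A → ℚ) (xs ys : List A) →
                sumℚ (map f (xs ++ ys)) ≡ sumℚ (map f xs) + sumℚ (map f ys)
  sumℚ-map-++ f []       ys = sym (ℚₚ.+-identityˡ _)
  sumℚ-map-++ f (x ∷ xs) ys = trans (cong (_+_ (f x)) (sumℚ-map-++ f xs ys))
    (sym (ℚₚ.+-assoc (f x) (sumℚ (map f xs)) (sumℚ (map f ys))))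

  sumℚ-map-∘ : ∀ {A B : Set} (f : B → ℚ) (g : A → B) (xs : List A) →
               sumℚ (map f (map g xs)) ≡ sumℚ (map (λ x → f (g x)) xs)
  sumℚ-map-∘ f g []       = refl
  sumℚ-map-∘ f g (x ∷ xs) = cong (_+_ (f (g x))) (sumℚ-map-∘ f g xs)

  sumℚ-map-cong : ∀ {A : Set} {f g : A → ℚ} (xs : List A) → (∀ x → f x ≡ g x) →
                  sumℚ (map f xs) ≡ sumℚ (map g xs)
  sumℚ-map-cong []       f≗g = refl
  sumℚ-map-cong (x ∷ xs) f≗g = cong₂ _+_ (f≗g x) (sumℚ-map-cong xs f≗g)

  sumℚ-map-*ˡ : ∀ {A : Set} c (f : A → ℚ) (xs : List A) →
                sumℚ (map (λ x → c * f x) xs) ≡ c * sumℚ (map f xs)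
  sumℚ-map-*ˡ c f []       = sym (ℚₚ.*-zeroʳ c)
  sumℚ-map-*ˡ c f (x ∷ xs) = trans (cong (_+_ (c * f x)) (sumℚ-map-*ˡ c f xs))
    (sym (ℚₚ.*-distribˡ-+ c (f x) (sumℚ (map f xs))))

  sumℚ-map-- : ∀ {A : Set} (f g : A → ℚ) (xs : List A) →
               sumℚ (map (λ x → f x - g x) xs) ≡ sumℚ (map f xs) - sumℚ (map g xs)
  sumℚ-map-- f g []       = refl
  sumℚ-map-- f g (x ∷ xs) = trans (cong (_+_ (f x - g x)) (sumℚ-map-- f g xs))
    (interchange (f x) (g x) (sumℚ (map f xs)) (sumℚ (map g xs)))
    where
    interchange : ∀ a b c d → (a - b) + (c - d) ≡ (a + c) - (b + d)
    interchange = solve-∀ ℚ-ring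

  sumℚ-sumTo-comm : ∀ {A : Set} n (f : A → ℕ → ℚ) (xs : List A) →
                    sumℚ (map (λ x → sumTo n (f x)) xs) ≡ sumTo n (λ k → sumℚ (map (λ x → f x k) xs))
  sumℚ-sumTo-comm n f []       = sym (sumTo-0 n)
  sumℚ-sumTo-comm n f (x ∷ xs) = trans (cong (_+_ (sumTo n (f x))) (sumℚ-sumTo-comm n f xs))
    (sym (sumTo-+ n (f x) (λ k → sumℚ (map (λ y → f y k) xs))))

module BinomialWeights where

  open import Data.Nat as ℕ using (ℕ; zero; suc)
  import Data.Nat.Properties as ℕₚ
  open import Data.Nat.Combinatorics using (_C_; nCk+nC[k+1]≡[n+1]C[k+1]; nC1≡n; k>n⇒nCk≡0)
  open import Data.Rational using (ℚ; 0ℚ; 1ℚ; _+_; _*_; _-_)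
  import Data.Rational.Properties as ℚₚ
  open import Data.Product using (∃; _,_)
  open import Relation.Binary.PropositionalEquality
  open import Tactic.RingSolver using (solve-∀)
  open RationalSums

  [k+1]*[n+1]C[k+1]≡[n+1]*nCk : ∀ n k → suc k ℕ.* (suc n C suc k) ≡ suc n ℕ.* (n C k)
  [k+1]*[n+1]C[k+1]≡[n+1]*nCk zero    zero    = refl
  [k+1]*[n+1]C[k+1]≡[n+1]*nCk zero    (suc k) = ℕₚ.*-zeroʳ (suc (suc k))
  [k+1]*[n+1]C[k+1]≡[n+1]*nCk (suc n) zero    =
    trans (ℕₚ.*-identityˡ _) (trans (nC1≡n (suc (suc n))) (sym (ℕₚ.*-identityʳ _)))
  [k+1]*[n+1]C[k+1]≡[n+1]*nCk (suc n) (suc k) = begin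
    suc (suc k) ℕ.* (suc (suc n) C suc (suc k))
      ≡⟨ cong (suc (suc k) ℕ.*_) (sym (nCk+nC[k+1]≡[n+1]C[k+1] (suc n) (suc k))) ⟩
    suc (suc k) ℕ.* (x ℕ.+ y)
      ≡⟨ ℕₚ.*-distribˡ-+ (suc (suc k)) x y ⟩
    (x ℕ.+ suc k ℕ.* x) ℕ.+ suc (suc k) ℕ.* y
      ≡⟨ ℕₚ.+-assoc x (suc k ℕ.* x) _ ⟩
    x ℕ.+ (suc k ℕ.* x ℕ.+ suc (suc k) ℕ.* y)
      ≡⟨ cong (x ℕ.+_) (cong₂ ℕ._+_ ([k+1]*[n+1]C[k+1]≡[n+1]*nCk n k) ([k+1]*[n+1]C[k+1]≡[n+1]*nCk n (suc k))) ⟩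
    x ℕ.+ (suc n ℕ.* (n C k) ℕ.+ suc n ℕ.* (n C suc k))
      ≡⟨ cong (x ℕ.+_) (sym (ℕₚ.*-distribˡ-+ (suc n) (n C k) (n C suc k))) ⟩
    x ℕ.+ suc n ℕ.* (n C k ℕ.+ n C suc k)
      ≡⟨ cong (λ z → x ℕ.+ suc n ℕ.* z) (nCk+nC[k+1]≡[n+1]C[k+1] n k) ⟩
    suc (suc n) ℕ.* x ∎
    where
    open ≡-Reasoning
    x = suc n C suc k
    y = suc n C suc (suc k)

  [n+k]Ck≡suc : ∀ n k → ∃ λ d → (n ℕ.+ k) C k ≡ suc d
  [n+k]Ck≡suc n zero    = 0 , refl
  [n+k]Ck≡suc n (suc k) with [n+k]Ck≡suc n k
  ... | d , eq = d ℕ.+ (n ℕ.+ k) C suc k , (begin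
    (n ℕ.+ suc k) C suc k                ≡⟨ cong (_C suc k) (ℕₚ.+-suc n k) ⟩
    suc (n ℕ.+ k) C suc k                ≡⟨ sym (nCk+nC[k+1]≡[n+1]C[k+1] (n ℕ.+ k) k) ⟩
    (n ℕ.+ k) C k ℕ.+ (n ℕ.+ k) C suc k  ≡⟨ cong (ℕ._+ (n ℕ.+ k) C suc k) eq ⟩
    suc d ℕ.+ (n ℕ.+ k) C suc k          ∎)
    where open ≡-Reasoning

  w : ℕ → ℕ → ℚ
  w n k = ratio (n C k) ((n ℕ.+ k) C k)

  w*[n+k]Ck≡nCk : ∀ n k → w n k * ⟦ (n ℕ.+ k) C k ⟧ ≡ ⟦ n C k ⟧
  w*[n+k]Ck≡nCk n k with (n ℕ.+ k) C k | [n+k]Ck≡suc n k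
  ... | .(suc d) | d , refl = ratio-*-denominator (n C k) d

  [n+k]Ck-inverseʳ : ∀ n k → ⟦ (n ℕ.+ k) C k ⟧ * 1/ℕ ((n ℕ.+ k) C k) ≡ 1ℚ
  [n+k]Ck-inverseʳ n k with (n ℕ.+ k) C k | [n+k]Ck≡suc n k
  ... | .(suc d) | d , refl = 1/ℕ-inverseʳ d

  w-[1+n] : ∀ n → w n (suc n) ≡ 0ℚ
  w-[1+n] n = *-cancelʳ-invertible ⟦ (n ℕ.+ suc n) C suc n ⟧ (1/ℕ ((n ℕ.+ suc n) C suc n)) ([n+k]Ck-inverseʳ n (suc n))
    (trans (w*[n+k]Ck≡nCk n (suc n))
      (trans (cong ⟦_⟧ (k>n⇒nCk≡0 (ℕₚ.n<1+n n))) (sym (ℚₚ.*-zeroˡ ⟦ (n ℕ.+ suc n) C suc n ⟧))))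

  [k+1]*nC[k+1]≡[n-k]*nCk : ∀ n k → (⟦ k ⟧ + 1ℚ) * ⟦ n C suc k ⟧ ≡ (⟦ n ⟧ - ⟦ k ⟧) * ⟦ n C k ⟧
  [k+1]*nC[k+1]≡[n-k]*nCk n k = begin
    K1 * ⟦ n C suc k ⟧                                ≡⟨ subtract-c₀ K1 ⟦ n C k ⟧ ⟦ n C suc k ⟧ ⟩
    K1 * (⟦ n C k ⟧ + ⟦ n C suc k ⟧) - K1 * ⟦ n C k ⟧ ≡⟨ cong (_- K1 * ⟦ n C k ⟧) pascal-absorption ⟩
    (⟦ n ⟧ + 1ℚ) * ⟦ n C k ⟧ - K1 * ⟦ n C k ⟧         ≡⟨ difference ⟦ n ⟧ ⟦ k ⟧ ⟦ n C k ⟧ ⟩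
    (⟦ n ⟧ - ⟦ k ⟧) * ⟦ n C k ⟧                       ∎
    where
    open ≡-Reasoning
    K1 = ⟦ k ⟧ + 1ℚ
    subtract-c₀ : ∀ x c₀ c₁ → x * c₁ ≡ x * (c₀ + c₁) - x * c₀
    subtract-c₀ = solve-∀ ℚ-ring
    difference : ∀ n k c → (n + 1ℚ) * c - (k + 1ℚ) * c ≡ (n - k) * c
    difference = solve-∀ ℚ-ring
    pascal-absorption : K1 * (⟦ n C k ⟧ + ⟦ n C suc k ⟧) ≡ (⟦ n ⟧ + 1ℚ) * ⟦ n C k ⟧
    pascal-absorption = begin
      K1 * (⟦ n C k ⟧ + ⟦ n C suc k ⟧)    ≡⟨ cong₂ _*_ (sym (⟦suc⟧ k)) (sym (⟦+⟧ (n C k) (n C suc k))) ⟩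
      ⟦ suc k ⟧ * ⟦ n C k ℕ.+ n C suc k ⟧ ≡⟨ sym (⟦*⟧ (suc k) (n C k ℕ.+ n C suc k)) ⟩
      ⟦ suc k ℕ.* (n C k ℕ.+ n C suc k) ⟧ ≡⟨ cong (λ z → ⟦ suc k ℕ.* z ⟧) (nCk+nC[k+1]≡[n+1]C[k+1] n k) ⟩
      ⟦ suc k ℕ.* (suc n C suc k) ⟧       ≡⟨ cong ⟦_⟧ ([k+1]*[n+1]C[k+1]≡[n+1]*nCk n k) ⟩
      ⟦ suc n ℕ.* (n C k) ⟧               ≡⟨ ⟦*⟧ (suc n) (n C k) ⟩
      ⟦ suc n ⟧ * ⟦ n C k ⟧               ≡⟨ cong (_* ⟦ n C k ⟧) (⟦suc⟧ n) ⟩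
      (⟦ n ⟧ + 1ℚ) * ⟦ n C k ⟧            ∎

  [k+1]*[n+k+1]C[k+1]≡[n+k+1]*[n+k]Ck : ∀ n k →
    (⟦ k ⟧ + 1ℚ) * ⟦ (n ℕ.+ suc k) C suc k ⟧ ≡ (⟦ n ⟧ + ⟦ k ⟧ + 1ℚ) * ⟦ (n ℕ.+ k) C k ⟧
  [k+1]*[n+k+1]C[k+1]≡[n+k+1]*[n+k]Ck n k = begin
    (⟦ k ⟧ + 1ℚ) * ⟦ (n ℕ.+ suc k) C suc k ⟧
      ≡⟨ cong₂ _*_ (sym (⟦suc⟧ k)) (cong (λ z → ⟦ z C suc k ⟧) (ℕₚ.+-suc n k)) ⟩
    ⟦ suc k ⟧ * ⟦ suc (n ℕ.+ k) C suc k ⟧  ≡⟨ sym (⟦*⟧ (suc k) (suc (n ℕ.+ k) C suc k)) ⟩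
    ⟦ suc k ℕ.* (suc (n ℕ.+ k) C suc k) ⟧  ≡⟨ cong ⟦_⟧ ([k+1]*[n+1]C[k+1]≡[n+1]*nCk (n ℕ.+ k) k) ⟩
    ⟦ suc (n ℕ.+ k) ℕ.* ((n ℕ.+ k) C k) ⟧  ≡⟨ ⟦*⟧ (suc (n ℕ.+ k)) ((n ℕ.+ k) C k) ⟩
    ⟦ suc (n ℕ.+ k) ⟧ * ⟦ (n ℕ.+ k) C k ⟧
      ≡⟨ cong (_* ⟦ (n ℕ.+ k) C k ⟧) (trans (⟦suc⟧ (n ℕ.+ k)) (cong (_+ 1ℚ) (⟦+⟧ n k))) ⟩
    (⟦ n ⟧ + ⟦ k ⟧ + 1ℚ) * ⟦ (n ℕ.+ k) C k ⟧ ∎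
    where open ≡-Reasoning

  w-step : ∀ n k → (⟦ n ⟧ + ⟦ k ⟧ + 1ℚ) * w n (suc k) ≡ (⟦ n ⟧ - ⟦ k ⟧) * w n k
  w-step n k = *-cancelʳ-invertible (d₀ * d₁ * K1) (1/ℕ ((n ℕ.+ k) C k) * 1/ℕ ((n ℕ.+ suc k) C suc k) * 1/ℕ (suc k))
    (trans (interchange₃ d₀ d₁ K1 _ _ _)
      (cong₂ _*_ (cong₂ _*_ ([n+k]Ck-inverseʳ n k) ([n+k]Ck-inverseʳ n (suc k)))
                 (trans (cong (_* 1/ℕ (suc k)) (sym (⟦suc⟧ k))) (1/ℕ-inverseʳ k))))
    (begin
      ((N + K + 1ℚ) * b) * (d₀ * d₁ * K1) ≡⟨ regroup₁ N K b d₀ d₁ ⟩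
      ((N + K + 1ℚ) * d₀) * (b * d₁ * K1) ≡⟨ cong (_* (b * d₁ * K1)) (sym ([k+1]*[n+k+1]C[k+1]≡[n+k+1]*[n+k]Ck n k)) ⟩
      (K1 * d₁) * (b * d₁ * K1)           ≡⟨ regroup₂ K b d₁ ⟩
      (K1 * (b * d₁)) * (d₁ * K1)         ≡⟨ cong (λ z → (K1 * z) * (d₁ * K1)) (w*[n+k]Ck≡nCk n (suc k)) ⟩
      (K1 * ⟦ n C suc k ⟧) * (d₁ * K1)    ≡⟨ cong (_* (d₁ * K1)) ([k+1]*nC[k+1]≡[n-k]*nCk n k) ⟩
      ((N - K) * ⟦ n C k ⟧) * (d₁ * K1)   ≡⟨ cong (λ z → ((N - K) * z) * (d₁ * K1)) (sym (w*[n+k]Ck≡nCk n k)) ⟩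
      ((N - K) * (a * d₀)) * (d₁ * K1)    ≡⟨ regroup₃ N K a d₀ d₁ ⟩
      ((N - K) * a) * (d₀ * d₁ * K1)      ∎)
    where
    open ≡-Reasoning
    N = ⟦ n ⟧
    K = ⟦ k ⟧
    K1 = K + 1ℚ
    a = w n k
    b = w n (suc k)
    d₀ = ⟦ (n ℕ.+ k) C k ⟧
    d₁ = ⟦ (n ℕ.+ suc k) C suc k ⟧
    interchange₃ : ∀ x y z x′ y′ z′ → (x * y * z) * (x′ * y′ * z′) ≡ (x * x′) * (y * y′) * (z * z′)
    interchange₃ = solve-∀ ℚ-ring
    regroup₁ : ∀ N K b d₀ d₁ → ((N + K + 1ℚ) * b) * (d₀ * d₁ * (K + 1ℚ)) ≡ ((N + K + 1ℚ) * d₀) * (b * d₁ * (K + 1ℚ))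
    regroup₁ = solve-∀ ℚ-ring
    regroup₂ : ∀ K b d₁ → ((K + 1ℚ) * d₁) * (b * d₁ * (K + 1ℚ)) ≡ ((K + 1ℚ) * (b * d₁)) * (d₁ * (K + 1ℚ))
    regroup₂ = solve-∀ ℚ-ring
    regroup₃ : ∀ N K a d₀ d₁ → ((N - K) * (a * d₀)) * (d₁ * (K + 1ℚ)) ≡ ((N - K) * a) * (d₀ * d₁ * (K + 1ℚ))
    regroup₃ = solve-∀ ℚ-ring

  w-suc-* : ∀ n k → w (suc n) k * ((⟦ n ⟧ + 1ℚ - ⟦ k ⟧) * (⟦ n ⟧ + 1ℚ + ⟦ k ⟧)) ≡ (⟦ n ⟧ + 1ℚ) * (⟦ n ⟧ + 1ℚ) * w n k
  w-suc-* n zero = square ⟦ n ⟧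
    where
    square : ∀ N → 1ℚ * ((N + 1ℚ - 0ℚ) * (N + 1ℚ + 0ℚ)) ≡ (N + 1ℚ) * (N + 1ℚ) * 1ℚ
    square = solve-∀ ℚ-ring
  w-suc-* n (suc k) rewrite ⟦suc⟧ k =
    *-cancelʳ-invertible (N + K + 1ℚ) (1/ℕ (suc (n ℕ.+ k)))
      (trans (cong (_* 1/ℕ (suc (n ℕ.+ k))) (sym (trans (⟦suc⟧ (n ℕ.+ k)) (cong (_+ 1ℚ) (⟦+⟧ n k)))))
             (1/ℕ-inverseʳ (n ℕ.+ k)))
      (begin
        (b′ * ((N + 1ℚ - (K + 1ℚ)) * (N + 1ℚ + (K + 1ℚ)))) * (N + K + 1ℚ) ≡⟨ regroup₁ N K b′ ⟩
        (N - K) * (N + K + 1ℚ) * ((N + 1ℚ + K + 1ℚ) * b′)                  ≡⟨ cong ((N - K) * (N + K + 1ℚ) *_) step-suc ⟩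
        (N - K) * (N + K + 1ℚ) * ((N + 1ℚ - K) * a′)                        ≡⟨ regroup₂ N K a′ ⟩
        (N - K) * (a′ * ((N + 1ℚ - K) * (N + 1ℚ + K)))                      ≡⟨ cong ((N - K) *_) (w-suc-* n k) ⟩
        (N - K) * ((N + 1ℚ) * (N + 1ℚ) * a)                                 ≡⟨ regroup₃ N K a ⟩
        (N + 1ℚ) * (N + 1ℚ) * ((N - K) * a)                                 ≡⟨ cong ((N + 1ℚ) * (N + 1ℚ) *_) (sym (w-step n k)) ⟩
        (N + 1ℚ) * (N + 1ℚ) * ((N + K + 1ℚ) * b)                            ≡⟨ regroup₄ N K b ⟩
        ((N + 1ℚ) * (N + 1ℚ) * b) * (N + K + 1ℚ)                            ∎)
    where
    open ≡-Reasoning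
    N = ⟦ n ⟧
    K = ⟦ k ⟧
    a = w n k
    b = w n (suc k)
    a′ = w (suc n) k
    b′ = w (suc n) (suc k)
    step-suc : (N + 1ℚ + K + 1ℚ) * b′ ≡ (N + 1ℚ - K) * a′
    step-suc = subst (λ z → (z + K + 1ℚ) * b′ ≡ (z - K) * a′) (⟦suc⟧ n) (w-step (suc n) k)
    regroup₁ : ∀ N K b → (b * ((N + 1ℚ - (K + 1ℚ)) * (N + 1ℚ + (K + 1ℚ)))) * (N + K + 1ℚ)
                         ≡ (N - K) * (N + K + 1ℚ) * ((N + 1ℚ + K + 1ℚ) * b)
    regroup₁ = solve-∀ ℚ-ring
    regroup₂ : ∀ N K a → (N - K) * (N + K + 1ℚ) * ((N + 1ℚ - K) * a) ≡ (N - K) * (a * ((N + 1ℚ - K) * (N + 1ℚ + K)))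
    regroup₂ = solve-∀ ℚ-ring
    regroup₃ : ∀ N K a → (N - K) * ((N + 1ℚ) * (N + 1ℚ) * a) ≡ (N + 1ℚ) * (N + 1ℚ) * ((N - K) * a)
    regroup₃ = solve-∀ ℚ-ring
    regroup₄ : ∀ N K b → (N + 1ℚ) * (N + 1ℚ) * ((N + K + 1ℚ) * b) ≡ ((N + 1ℚ) * (N + 1ℚ) * b) * (N + K + 1ℚ)
    regroup₄ = solve-∀ ℚ-ring

  w-suc-∸ : ∀ n k → w (suc n) k - w n k ≡ 1/ℕ (suc n ℕ.* suc n) * (⟦ k ⟧ * ⟦ k ⟧ * w (suc n) k)
  w-suc-∸ n k = *-cancelʳ-invertible ⟦ suc n ℕ.* suc n ⟧ (1/ℕ (suc n ℕ.* suc n)) (1/ℕ-inverseʳ (n ℕ.+ n ℕ.* suc n))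
    (begin
      (a′ - a) * ⟦ suc n ℕ.* suc n ⟧                  ≡⟨ cong ((a′ - a) *_) ⟦M²⟧ ⟩
      (a′ - a) * (M * M)                              ≡⟨ expand a′ a M ⟩
      a′ * (M * M) - M * M * a                        ≡⟨ cong (a′ * (M * M) -_) (sym (w-suc-* n k)) ⟩
      a′ * (M * M) - a′ * ((M - K) * (M + K))         ≡⟨ difference-of-squares a′ M K ⟩
      K * K * a′                                      ≡⟨ sym (*-identityˡ-≡1 (K * K * a′) (1/ℕ-inverseˡ (n ℕ.+ n ℕ.* suc n))) ⟩
      1/ℕ (suc n ℕ.* suc n) * ⟦ suc n ℕ.* suc n ⟧ * (K * K * a′)  ≡⟨ swap-last (1/ℕ (suc n ℕ.* suc n)) ⟦ suc n ℕ.* suc n ⟧ (K * K * a′) ⟩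
      1/ℕ (suc n ℕ.* suc n) * (K * K * a′) * ⟦ suc n ℕ.* suc n ⟧  ∎)
    where
    open ≡-Reasoning
    M = ⟦ n ⟧ + 1ℚ
    K = ⟦ k ⟧
    a = w n k
    a′ = w (suc n) k
    ⟦M²⟧ : ⟦ suc n ℕ.* suc n ⟧ ≡ M * M
    ⟦M²⟧ = trans (⟦*⟧ (suc n) (suc n)) (cong₂ _*_ (⟦suc⟧ n) (⟦suc⟧ n))
    expand : ∀ a′ a M → (a′ - a) * (M * M) ≡ a′ * (M * M) - M * M * a
    expand = solve-∀ ℚ-ring
    difference-of-squares : ∀ a′ M K → a′ * (M * M) - a′ * ((M - K) * (M + K)) ≡ K * K * a′
    difference-of-squares = solve-∀ ℚ-ring
    swap-last : ∀ x y z → x * y * z ≡ x * z * y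
    swap-last = solve-∀ ℚ-ring

  -- Telescoping in n with w-suc-∸; the new term w n (1 + n) vanishes.
  sum-w-by-levels : ∀ (g : ℕ → ℚ) n →
    sumTo n (λ k → w n k * g k) ≡ sumTo n (λ m → 1/ℕ (m ℕ.* m) * sumTo m (λ k → ⟦ k ⟧ * ⟦ k ⟧ * w m k * g k))
  sum-w-by-levels g zero    = refl
  sum-w-by-levels g (suc n) = begin
    sumTo (suc n) (λ k → w (suc n) k * g k)
      ≡⟨ sumTo-cong (suc n) (λ k → split (⟦ suc k ⟧ * ⟦ suc k ⟧) (w (suc n) (suc k)) (w n (suc k)) (g (suc k)) (w-suc-∸ n (suc k))) ⟩
    sumTo (suc n) (λ k → w n k * g k + 1/M² * G k)
      ≡⟨ sumTo-+ (suc n) (λ k → w n k * g k) (λ k → 1/M² * G k) ⟩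
    sumTo (suc n) (λ k → w n k * g k) + sumTo (suc n) (λ k → 1/M² * G k)
      ≡⟨ cong₂ _+_ drop-last (sumTo-*ˡ (suc n) 1/M² G) ⟩
    sumTo n (λ k → w n k * g k) + 1/M² * sumTo (suc n) G
      ≡⟨ cong (_+ 1/M² * sumTo (suc n) G) (sum-w-by-levels g n) ⟩
    sumTo (suc n) (λ m → 1/ℕ (m ℕ.* m) * sumTo m (λ k → ⟦ k ⟧ * ⟦ k ⟧ * w m k * g k)) ∎
    where
    open ≡-Reasoning
    1/M² = 1/ℕ (suc n ℕ.* suc n)
    G = λ k → ⟦ k ⟧ * ⟦ k ⟧ * w (suc n) k * g k
    split : ∀ K² a′ a x → a′ - a ≡ 1/M² * (K² * a′) → a′ * x ≡ a * x + 1/M² * (K² * a′ * x)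
    split K² a′ a x eq = trans (add-∸ a′ a x) (trans (cong (λ d → a * x + d * x) eq) (assoc a x 1/M² K² a′))
      where
      add-∸ : ∀ a′ a x → a′ * x ≡ a * x + (a′ - a) * x
      add-∸ = solve-∀ ℚ-ring
      assoc : ∀ a x c K² a′ → a * x + c * (K² * a′) * x ≡ a * x + c * (K² * a′ * x)
      assoc = solve-∀ ℚ-ring
    drop-last : sumTo (suc n) (λ k → w n k * g k) ≡ sumTo n (λ k → w n k * g k)
    drop-last = trans (cong (λ z → sumTo n (λ k → w n k * g k) + z * g (suc n)) (w-[1+n] n))
      (trans (cong (sumTo n (λ k → w n k * g k) +_) (ℚₚ.*-zeroˡ (g (suc n)))) (ℚₚ.+-identityʳ _))

module BinomialTransform where

  open import Data.Nat as ℕ using (ℕ; zero; suc; _∸_; _^_)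
  import Data.Nat.Properties as ℕₚ
  open import Data.Integer using (ℤ; +_; -[1+_])
  open import Data.Rational using (ℚ; 0ℚ; 1ℚ; _+_; _*_; -_; _-_)
  import Data.Rational.Properties as ℚₚ
  open import Relation.Binary.PropositionalEquality
  open import Tactic.RingSolver using (solve-∀)
  open RationalSums
  open BinomialWeights

  Δ : (ℕ → ℚ) → ℕ → ℚ
  Δ V k = V k - V (k ∸ 1)

  Δ⁺ : (ℕ → ℚ) → ℕ → ℚ
  Δ⁺ V k = V k + V (k ∸ 1)

  Φ : ℕ → (ℕ → ℚ) → ℚ
  Φ n V = sumTo n (λ k → w n k * Δ V k)

  -1^_ : ℕ → ℚ
  -1^ k = sgnPow -[1+ 0 ] k

  Φ-cong : ∀ n {U V : ℕ → ℚ} → (∀ k → U k ≡ V k) → Φ n U ≡ Φ n V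
  Φ-cong n U≗V = sumTo-cong n (λ k → cong (w n (suc k) *_) (cong₂ _-_ (U≗V (suc k)) (U≗V k)))

  sum-k-w-Δ⁺-partial : ∀ n (V : ℕ → ℚ) m →
    ⟦ n ⟧ * sumTo m (λ k → w n k * Δ V k) - sumTo m (λ k → ⟦ k ⟧ * w n k * Δ⁺ V k)
      ≡ (⟦ n ⟧ - ⟦ m ⟧) * w n m * V m - ⟦ n ⟧ * V 0
  sum-k-w-Δ⁺-partial n V zero = base ⟦ n ⟧ (V 0)
    where
    base : ∀ N v → N * 0ℚ - 0ℚ ≡ (N - 0ℚ) * 1ℚ * v - N * v
    base = solve-∀ ℚ-ring
  sum-k-w-Δ⁺-partial n V (suc m) rewrite ⟦suc⟧ m = begin
    N * (A + w₁ * (V₁ - V₀)) - (B + (M + 1ℚ) * w₁ * (V₁ + V₀))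
      ≡⟨ regroup₁ N M w₁ V₀ V₁ A B ⟩
    (N * A - B) + (N * w₁ * (V₁ - V₀) - (M + 1ℚ) * w₁ * (V₁ + V₀))
      ≡⟨ cong (_+ (N * w₁ * (V₁ - V₀) - (M + 1ℚ) * w₁ * (V₁ + V₀))) (sum-k-w-Δ⁺-partial n V m) ⟩
    ((N - M) * w n m * V₀ - N * V 0) + (N * w₁ * (V₁ - V₀) - (M + 1ℚ) * w₁ * (V₁ + V₀))
      ≡⟨ cong (λ z → (z * V₀ - N * V 0) + (N * w₁ * (V₁ - V₀) - (M + 1ℚ) * w₁ * (V₁ + V₀))) (sym (w-step n m)) ⟩
    ((N + M + 1ℚ) * w₁ * V₀ - N * V 0) + (N * w₁ * (V₁ - V₀) - (M + 1ℚ) * w₁ * (V₁ + V₀))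
      ≡⟨ regroup₂ N M w₁ V₀ V₁ (V 0) ⟩
    (N - (M + 1ℚ)) * w₁ * V₁ - N * V 0 ∎
    where
    open ≡-Reasoning
    N = ⟦ n ⟧
    M = ⟦ m ⟧
    w₁ = w n (suc m)
    V₀ = V m
    V₁ = V (suc m)
    A = sumTo m (λ k → w n k * Δ V k)
    B = sumTo m (λ k → ⟦ k ⟧ * w n k * Δ⁺ V k)
    regroup₁ : ∀ N M w₁ V₀ V₁ A B → N * (A + w₁ * (V₁ - V₀)) - (B + (M + 1ℚ) * w₁ * (V₁ + V₀))
                                    ≡ (N * A - B) + (N * w₁ * (V₁ - V₀) - (M + 1ℚ) * w₁ * (V₁ + V₀))
    regroup₁ = solve-∀ ℚ-ring
    regroup₂ : ∀ N M w₁ V₀ V₁ v → ((N + M + 1ℚ) * w₁ * V₀ - N * v) + (N * w₁ * (V₁ - V₀) - (M + 1ℚ) * w₁ * (V₁ + V₀))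
                                  ≡ (N - (M + 1ℚ)) * w₁ * V₁ - N * v
    regroup₂ = solve-∀ ℚ-ring

  sum-k-w-Δ⁺ : ∀ n (V : ℕ → ℚ) → sumTo n (λ k → ⟦ k ⟧ * w n k * Δ⁺ V k) ≡ ⟦ n ⟧ * Φ n V + ⟦ n ⟧ * V 0
  sum-k-w-Δ⁺ n V = solve-for-S _ (Φ n V) ⟦ n ⟧ (w n n) (V n) (V 0) (sum-k-w-Δ⁺-partial n V n)
    where
    solve-for-S : ∀ S P N a v v₀ → N * P - S ≡ (N - N) * a * v - N * v₀ → S ≡ N * P + N * v₀
    solve-for-S S P N a v v₀ eq = trans (isolate S P N) (trans (cong (_-_ (N * P)) eq) (vanish N P a v v₀))
      where
      isolate : ∀ S P N → S ≡ N * P - (N * P - S)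
      isolate = solve-∀ ℚ-ring
      vanish : ∀ N P a v v₀ → N * P - ((N - N) * a * v - N * v₀) ≡ N * P + N * v₀
      vanish = solve-∀ ℚ-ring

  sum-sgn-w-Δ⁺-partial : ∀ n (V : ℕ → ℚ) m →
    ⟦ n ⟧ * sumTo m (λ k → -1^ k * w n k * Δ⁺ V k) - sumTo m (λ k → -1^ k * ⟦ k ⟧ * w n k * Δ V k)
      ≡ -1^ m * (⟦ n ⟧ - ⟦ m ⟧) * w n m * V m - ⟦ n ⟧ * V 0
  sum-sgn-w-Δ⁺-partial n V zero = base ⟦ n ⟧ (V 0)
    where
    base : ∀ N v → N * 0ℚ - 0ℚ ≡ 1ℚ * (N - 0ℚ) * 1ℚ * v - N * v
    base = solve-∀ ℚ-ring
  sum-sgn-w-Δ⁺-partial n V (suc m) rewrite ⟦suc⟧ m = begin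
    N * (A + (- s) * w₁ * (V₁ + V₀)) - (B + (- s) * (M + 1ℚ) * w₁ * (V₁ - V₀))
      ≡⟨ regroup₁ N M s w₁ V₀ V₁ A B ⟩
    (N * A - B) + X
      ≡⟨ cong (_+ X) (sum-sgn-w-Δ⁺-partial n V m) ⟩
    (s * (N - M) * w n m * V₀ - N * V 0) + X
      ≡⟨ cong (λ z → (z * V₀ - N * V 0) + X) (ℚₚ.*-assoc s (N - M) (w n m)) ⟩
    (s * ((N - M) * w n m) * V₀ - N * V 0) + X
      ≡⟨ cong (λ z → (s * z * V₀ - N * V 0) + X) (sym (w-step n m)) ⟩
    (s * ((N + M + 1ℚ) * w₁) * V₀ - N * V 0) + X
      ≡⟨ regroup₂ N M s w₁ V₀ V₁ (V 0) ⟩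
    (- s) * (N - (M + 1ℚ)) * w₁ * V₁ - N * V 0 ∎
    where
    open ≡-Reasoning
    N = ⟦ n ⟧
    M = ⟦ m ⟧
    s = -1^ m
    w₁ = w n (suc m)
    V₀ = V m
    V₁ = V (suc m)
    A = sumTo m (λ k → -1^ k * w n k * Δ⁺ V k)
    B = sumTo m (λ k → -1^ k * ⟦ k ⟧ * w n k * Δ V k)
    X = s * (- N * w₁ * (V₁ + V₀) + (M + 1ℚ) * w₁ * (V₁ - V₀))
    regroup₁ : ∀ N M s w₁ V₀ V₁ A B → N * (A + (- s) * w₁ * (V₁ + V₀)) - (B + (- s) * (M + 1ℚ) * w₁ * (V₁ - V₀))
                                      ≡ (N * A - B) + s * (- N * w₁ * (V₁ + V₀) + (M + 1ℚ) * w₁ * (V₁ - V₀))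
    regroup₁ = solve-∀ ℚ-ring
    regroup₂ : ∀ N M s w₁ V₀ V₁ v →
      (s * ((N + M + 1ℚ) * w₁) * V₀ - N * v) + s * (- N * w₁ * (V₁ + V₀) + (M + 1ℚ) * w₁ * (V₁ - V₀))
        ≡ (- s) * (N - (M + 1ℚ)) * w₁ * V₁ - N * v
    regroup₂ = solve-∀ ℚ-ring

  sum-sgn-w-Δ⁺ : ∀ n (V : ℕ → ℚ) → V 0 ≡ 0ℚ →
    ⟦ n ⟧ * sumTo n (λ k → -1^ k * w n k * Δ⁺ V k) ≡ sumTo n (λ k → -1^ k * ⟦ k ⟧ * w n k * Δ V k)
  sum-sgn-w-Δ⁺ n V V0≡0 = equate _ _ (-1^ n) ⟦ n ⟧ (w n n) (V n) (V 0) V0≡0 (sum-sgn-w-Δ⁺-partial n V n)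
    where
    equate : ∀ X Y s N a v v₀ → v₀ ≡ 0ℚ → X - Y ≡ s * (N - N) * a * v - N * v₀ → X ≡ Y
    equate X Y s N a v .0ℚ refl eq = trans (split X Y) (trans (cong (_+ Y) eq) (vanish s N a v Y))
      where
      split : ∀ X Y → X ≡ (X - Y) + Y
      split = solve-∀ ℚ-ring
      vanish : ∀ s N a v Y → (s * (N - N) * a * v - N * 0ℚ) + Y ≡ Y
      vanish = solve-∀ ℚ-ring

  Σ⁻ : ℤ → (ℕ → ℚ) → ℕ → ℚ
  Σ⁻ x V k = sumTo k (λ j → term j x * Δ V j)

  Σ⁺ : ℤ → (ℕ → ℚ) → ℕ → ℚ
  Σ⁺ x V k = sumTo k (λ j → term j x * Δ⁺ V j)

  Σ⁺-cong : ∀ x {U V : ℕ → ℚ} k → (∀ j → U j ≡ V j) → Σ⁺ x U k ≡ Σ⁺ x V k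
  Σ⁺-cong x k U≗V = sumTo-cong k (λ j → cong (term (suc j) x *_) (cong₂ _+_ (U≗V (suc j)) (U≗V j)))

  Φ-partialSums : ∀ (g : ℕ → ℚ) n →
    Φ n (λ k → sumTo k g) ≡ sumTo n (λ m → 1/ℕ (m ℕ.* m) * sumTo m (λ k → ⟦ k ⟧ * ⟦ k ⟧ * w m k * g k))
  Φ-partialSums g n = trans (sumTo-cong n (λ k → cong (w n (suc k) *_) (sumTo-suc-∸ g k))) (sum-w-by-levels g n)

  sgnPow-neg : ∀ m k → sgnPow -[1+ m ] k ≡ -1^ k
  sgnPow-neg m zero    = refl
  sgnPow-neg m (suc k) = cong -_ (sgnPow-neg m k)

  -1^-square : ∀ k → -1^ k * -1^ k ≡ 1ℚ
  -1^-square zero    = refl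
  -1^-square (suc k) = trans (neg-square (-1^ k)) (-1^-square k)
    where
    neg-square : ∀ a → (- a) * (- a) ≡ a * a
    neg-square = solve-∀ ℚ-ring

  term-1 : ∀ k → term (suc k) (+ 1) ≡ 1/ℕ (suc k)
  term-1 k = trans (ℚₚ.*-identityˡ _) (cong 1/ℕ (ℕₚ.*-identityʳ (suc k)))

  term-2 : ∀ k → term (suc k) (+ 2) ≡ 1/ℕ (suc k ℕ.* suc k)
  term-2 k = trans (ℚₚ.*-identityˡ _) (cong (λ z → 1/ℕ (suc k ℕ.* z)) (ℕₚ.*-identityʳ (suc k)))

  term-[-1] : ∀ k → term (suc k) -[1+ 0 ] ≡ -1^ (suc k) * 1/ℕ (suc k)
  term-[-1] k = cong (-1^ (suc k) *_) (cong 1/ℕ (ℕₚ.*-identityʳ (suc k)))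

  term-[-2] : ∀ k → term (suc k) -[1+ 1 ] ≡ -1^ (suc k) * 1/ℕ (suc k ℕ.* suc k)
  term-[-2] k = cong₂ _*_ (sgnPow-neg 1 (suc k)) (cong (λ z → 1/ℕ (suc k ℕ.* z)) (ℕₚ.*-identityʳ (suc k)))

  k²*1/k² : ∀ k → ⟦ suc k ⟧ * ⟦ suc k ⟧ * 1/ℕ (suc k ℕ.* suc k) ≡ 1ℚ
  k²*1/k² k = trans (cong (_* 1/ℕ (suc k ℕ.* suc k)) (sym (⟦*⟧ (suc k) (suc k)))) (1/ℕ-inverseʳ (k ℕ.+ k ℕ.* suc k))

  1/k²*k : ∀ k → 1/ℕ (suc k ℕ.* suc k) * ⟦ suc k ⟧ ≡ 1/ℕ (suc k)
  1/k²*k k = trans (cong (_* ⟦ suc k ⟧) (1/ℕ-* (suc k) (suc k)))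
    (trans (regroup (1/ℕ (suc k)) ⟦ suc k ⟧) (*-identityˡ-≡1 (1/ℕ (suc k)) (1/ℕ-inverseʳ k)))
    where
    regroup : ∀ i K → i * i * K ≡ (K * i) * i
    regroup = solve-∀ ℚ-ring

  Φ-Σ⁺-1 : ∀ (V : ℕ → ℚ) → V 0 ≡ 0ℚ → ∀ n → Φ n (Σ⁺ (+ 1) V) ≡ sumTo n (λ m → term m (+ 1) * Φ m V)
  Φ-Σ⁺-1 V V0≡0 n = trans (Φ-partialSums _ n) (sumTo-cong n level)
    where
    open ≡-Reasoning
    cancel-k : ∀ K ω X i → K * K * ω * (i * X) ≡ (K * i) * (K * ω * X)
    cancel-k = solve-∀ ℚ-ring
    level : ∀ m → 1/ℕ (suc m ℕ.* suc m) * sumTo (suc m) (λ k → ⟦ k ⟧ * ⟦ k ⟧ * w (suc m) k * (term k (+ 1) * Δ⁺ V k))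
                ≡ term (suc m) (+ 1) * Φ (suc m) V
    level m = begin
      1/ℕ (suc m ℕ.* suc m) * sumTo (suc m) (λ k → ⟦ k ⟧ * ⟦ k ⟧ * w (suc m) k * (term k (+ 1) * Δ⁺ V k))
        ≡⟨ cong (1/ℕ (suc m ℕ.* suc m) *_) (sumTo-cong (suc m) λ k →
             trans (cong (λ t → ⟦ suc k ⟧ * ⟦ suc k ⟧ * w (suc m) (suc k) * (t * Δ⁺ V (suc k))) (term-1 k))
               (trans (cancel-k ⟦ suc k ⟧ (w (suc m) (suc k)) (Δ⁺ V (suc k)) (1/ℕ (suc k)))
                 (*-identityˡ-≡1 _ (1/ℕ-inverseʳ k)))) ⟩
      1/ℕ (suc m ℕ.* suc m) * sumTo (suc m) (λ k → ⟦ k ⟧ * w (suc m) k * Δ⁺ V k)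
        ≡⟨ cong (1/ℕ (suc m ℕ.* suc m) *_) (trans (sum-k-w-Δ⁺ (suc m) V)
             (trans (cong (λ v → ⟦ suc m ⟧ * Φ (suc m) V + ⟦ suc m ⟧ * v) V0≡0)
               (trans (cong (_+_ (⟦ suc m ⟧ * Φ (suc m) V)) (ℚₚ.*-zeroʳ ⟦ suc m ⟧)) (ℚₚ.+-identityʳ _)))) ⟩
      1/ℕ (suc m ℕ.* suc m) * (⟦ suc m ⟧ * Φ (suc m) V)
        ≡⟨ sym (ℚₚ.*-assoc (1/ℕ (suc m ℕ.* suc m)) ⟦ suc m ⟧ (Φ (suc m) V)) ⟩
      1/ℕ (suc m ℕ.* suc m) * ⟦ suc m ⟧ * Φ (suc m) V
        ≡⟨ cong (_* Φ (suc m) V) (trans (1/k²*k m) (sym (term-1 m))) ⟩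
      term (suc m) (+ 1) * Φ (suc m) V ∎

  Φ-Σ⁻-2 : ∀ (U : ℕ → ℚ) n → Φ n (Σ⁻ (+ 2) U) ≡ sumTo n (λ m → term m (+ 2) * Φ m U)
  Φ-Σ⁻-2 U n = trans (Φ-partialSums _ n) (sumTo-cong n λ m →
    cong₂ _*_ (sym (term-2 m)) (sumTo-cong (suc m) λ k →
      trans (cong (λ t → ⟦ suc k ⟧ * ⟦ suc k ⟧ * w (suc m) (suc k) * (t * Δ U (suc k))) (term-2 k))
        (trans (cancel-k² ⟦ suc k ⟧ (w (suc m) (suc k)) (Δ U (suc k)) (1/ℕ (suc k ℕ.* suc k)))
          (*-identityˡ-≡1 _ (k²*1/k² k)))))
    where
    cancel-k² : ∀ K ω X i → K * K * ω * (i * X) ≡ (K * K * i) * (ω * X)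
    cancel-k² = solve-∀ ℚ-ring

  Φ-2H₁ : ∀ n → Φ n (λ k → ⟦ 2 ⟧ * sumTo k (λ j → term j (+ 1) * 1ℚ)) ≡ sumTo n (λ m → term m (+ 1) * 1ℚ)
  Φ-2H₁ n = begin
    Φ n (λ k → ⟦ 2 ⟧ * sumTo k h)    ≡⟨ Φ-cong n (λ k → sym (sumTo-*ˡ k ⟦ 2 ⟧ h)) ⟩
    Φ n (λ k → sumTo k g)            ≡⟨ Φ-partialSums g n ⟩
    sumTo n (λ m → 1/ℕ (m ℕ.* m) * sumTo m (λ k → ⟦ k ⟧ * ⟦ k ⟧ * w m k * g k))
      ≡⟨ sumTo-cong n (λ m → trans (cong (1/ℕ (suc m ℕ.* suc m) *_) (trans (sumTo-cong (suc m) (inner m)) (sum-k-w m)))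
                                   (trans (1/k²*k m) (sym (trans (ℚₚ.*-identityʳ _) (term-1 m))))) ⟩
    sumTo n (λ m → term m (+ 1) * 1ℚ) ∎
    where
    open ≡-Reasoning
    h = λ j → term j (+ 1) * 1ℚ
    g = λ j → ⟦ 2 ⟧ * h j
    cancel-k : ∀ K ω i → K * K * ω * ((1ℚ + 1ℚ) * (i * 1ℚ)) ≡ (K * i) * (K * ω * (1ℚ + 1ℚ))
    cancel-k = solve-∀ ℚ-ring
    inner : ∀ m k → ⟦ suc k ⟧ * ⟦ suc k ⟧ * w (suc m) (suc k) * g (suc k) ≡ ⟦ suc k ⟧ * w (suc m) (suc k) * (1ℚ + 1ℚ)
    inner m k = trans (cong (λ t → ⟦ suc k ⟧ * ⟦ suc k ⟧ * w (suc m) (suc k) * ((1ℚ + 1ℚ) * (t * 1ℚ))) (term-1 k))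
      (trans (cancel-k ⟦ suc k ⟧ (w (suc m) (suc k)) (1/ℕ (suc k))) (*-identityˡ-≡1 _ (1/ℕ-inverseʳ k)))
    Φ-const : ∀ m → Φ m (λ _ → 1ℚ) ≡ 0ℚ
    Φ-const m = trans (sumTo-cong m (λ k → ℚₚ.*-zeroʳ (w m (suc k)))) (sumTo-0 m)
    sum-k-w : ∀ m → sumTo (suc m) (λ k → ⟦ k ⟧ * w (suc m) k * (1ℚ + 1ℚ)) ≡ ⟦ suc m ⟧
    sum-k-w m = trans (sum-k-w-Δ⁺ (suc m) (λ _ → 1ℚ))
      (trans (cong (λ z → ⟦ suc m ⟧ * z + ⟦ suc m ⟧ * 1ℚ) (Φ-const (suc m))) (only-second ⟦ suc m ⟧))
      where
      only-second : ∀ N → N * 0ℚ + N * 1ℚ ≡ N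
      only-second = solve-∀ ℚ-ring

  Ω : (ℕ → ℚ) → ℕ → ℕ → ℚ
  Ω U zero    = Σ⁻ -[1+ 0 ] U
  Ω U (suc m) = Σ⁺ (+ 1) (Ω U m)

  Ω-zero : ∀ U m → Ω U m 0 ≡ 0ℚ
  Ω-zero U zero    = refl
  Ω-zero U (suc m) = refl

  -- k ΔΩ(k) is (-1)^k ΔU(k) for m = 0 and Δ⁺Ω(k) at the previous level otherwise.
  mutual
    sum-sgn-k-w-ΔΩ : ∀ U m n →
      sumTo (suc n) (λ k → -1^ k * ⟦ k ⟧ * w (suc n) k * Δ (Ω U m) k) ≡ 1/ℕ (suc n ^ m) * Φ (suc n) U
    sum-sgn-k-w-ΔΩ U zero n = trans (sumTo-cong (suc n) inner) (sym (ℚₚ.*-identityˡ _))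
      where
      regroup : ∀ s K ω X i → s * K * ω * ((s * i) * X) ≡ (s * s) * ((K * i) * (ω * X))
      regroup = solve-∀ ℚ-ring
      inner : ∀ k → -1^ suc k * ⟦ suc k ⟧ * w (suc n) (suc k) * Δ (Ω U zero) (suc k) ≡ w (suc n) (suc k) * Δ U (suc k)
      inner k = trans (cong (-1^ suc k * ⟦ suc k ⟧ * w (suc n) (suc k) *_) (trans (sumTo-suc-∸ _ k) (cong (_* Δ U (suc k)) (term-[-1] k))))
        (trans (regroup (-1^ suc k) ⟦ suc k ⟧ (w (suc n) (suc k)) (Δ U (suc k)) (1/ℕ (suc k)))
          (trans (*-identityˡ-≡1 _ (-1^-square (suc k))) (*-identityˡ-≡1 _ (1/ℕ-inverseʳ k))))
    sum-sgn-k-w-ΔΩ U (suc m) n = trans (sumTo-cong (suc n) inner) (trans (sum-sgn-w-Δ⁺Ω U m n)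
        (trans (sym (ℚₚ.*-assoc (1/ℕ (suc n)) _ _)) (cong (_* Φ (suc n) U) (sym (1/ℕ-* (suc n) (suc n ^ m))))))
      where
      regroup : ∀ s K ω Y i → s * K * ω * (i * Y) ≡ (K * i) * (s * ω * Y)
      regroup = solve-∀ ℚ-ring
      inner : ∀ k → -1^ suc k * ⟦ suc k ⟧ * w (suc n) (suc k) * Δ (Ω U (suc m)) (suc k)
                  ≡ -1^ suc k * w (suc n) (suc k) * Δ⁺ (Ω U m) (suc k)
      inner k = trans (cong (-1^ suc k * ⟦ suc k ⟧ * w (suc n) (suc k) *_) (trans (sumTo-suc-∸ _ k) (cong (_* Δ⁺ (Ω U m) (suc k)) (term-1 k))))
        (trans (regroup (-1^ suc k) ⟦ suc k ⟧ (w (suc n) (suc k)) (Δ⁺ (Ω U m) (suc k)) (1/ℕ (suc k))) (*-identityˡ-≡1 _ (1/ℕ-inverseʳ k)))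

    sum-sgn-w-Δ⁺Ω : ∀ U m n →
      sumTo (suc n) (λ k → -1^ k * w (suc n) k * Δ⁺ (Ω U m) k) ≡ 1/ℕ (suc n) * (1/ℕ (suc n ^ m) * Φ (suc n) U)
    sum-sgn-w-Δ⁺Ω U m n = divide (trans (sum-sgn-w-Δ⁺ (suc n) (Ω U m) (Ω-zero U m)) (sum-sgn-k-w-ΔΩ U m n))
      where
      divide : ∀ {x y} → ⟦ suc n ⟧ * x ≡ y → x ≡ 1/ℕ (suc n) * y
      divide {x} {y} eq = trans (sym (*-identityˡ-≡1 x (1/ℕ-inverseˡ n)))
        (trans (ℚₚ.*-assoc (1/ℕ (suc n)) ⟦ suc n ⟧ x) (cong (1/ℕ (suc n) *_) eq))

  Φ-Σ⁺-[-2]-Ω : ∀ U m n → Φ n (Σ⁺ -[1+ 1 ] (Ω U m)) ≡ sumTo n (λ k → term k (+ (3 ℕ.+ m)) * Φ k U)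
  Φ-Σ⁺-[-2]-Ω U m n = trans (Φ-partialSums _ n) (sumTo-cong n level)
    where
    open ≡-Reasoning
    V = Ω U m
    regroup : ∀ K ω Y s i → K * K * ω * ((s * i) * Y) ≡ (K * K * i) * (s * ω * Y)
    regroup = solve-∀ ℚ-ring
    collect : ∀ i p F → (i * i) * (i * (p * F)) ≡ 1ℚ * (i * (i * (i * p))) * F
    collect = solve-∀ ℚ-ring
    level : ∀ j → 1/ℕ (suc j ℕ.* suc j) * sumTo (suc j) (λ k → ⟦ k ⟧ * ⟦ k ⟧ * w (suc j) k * (term k -[1+ 1 ] * Δ⁺ V k))
                ≡ term (suc j) (+ (3 ℕ.+ m)) * Φ (suc j) U
    level j = begin
      1/ℕ (N ℕ.* N) * sumTo N (λ k → ⟦ k ⟧ * ⟦ k ⟧ * w N k * (term k -[1+ 1 ] * Δ⁺ V k))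
        ≡⟨ cong (1/ℕ (N ℕ.* N) *_) (sumTo-cong N λ k →
             trans (cong (λ t → ⟦ suc k ⟧ * ⟦ suc k ⟧ * w N (suc k) * (t * Δ⁺ V (suc k))) (term-[-2] k))
               (trans (regroup ⟦ suc k ⟧ (w N (suc k)) (Δ⁺ V (suc k)) (-1^ suc k) (1/ℕ (suc k ℕ.* suc k)))
                 (*-identityˡ-≡1 _ (k²*1/k² k)))) ⟩
      1/ℕ (N ℕ.* N) * sumTo N (λ k → -1^ k * w N k * Δ⁺ V k)
        ≡⟨ cong (1/ℕ (N ℕ.* N) *_) (sum-sgn-w-Δ⁺Ω U m j) ⟩
      1/ℕ (N ℕ.* N) * (1/ℕ N * (1/ℕ (N ^ m) * Φ N U))
        ≡⟨ cong (_* (1/ℕ N * (1/ℕ (N ^ m) * Φ N U))) (1/ℕ-* N N) ⟩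
      (1/ℕ N * 1/ℕ N) * (1/ℕ N * (1/ℕ (N ^ m) * Φ N U))
        ≡⟨ collect (1/ℕ N) (1/ℕ (N ^ m)) (Φ N U) ⟩
      1ℚ * (1/ℕ N * (1/ℕ N * (1/ℕ N * 1/ℕ (N ^ m)))) * Φ N U
        ≡⟨ cong (λ z → 1ℚ * z * Φ N U) (sym (trans (1/ℕ-* N (N ℕ.* (N ℕ.* N ^ m)))
             (cong (1/ℕ N *_) (trans (1/ℕ-* N (N ℕ.* N ^ m)) (cong (1/ℕ N *_) (1/ℕ-* N (N ^ m))))))) ⟩
      term N (+ (3 ℕ.+ m)) * Φ N U ∎
      where
      N = suc j

module Expansions where

  open import Data.Nat as ℕ using (ℕ; zero; suc; _∸_; _^_)
  import Data.Nat.Properties as ℕₚ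
  open import Data.Integer as ℤ using (ℤ; +_; -[1+_]; NonZero)
  open import Data.Rational using (ℚ; 0ℚ; 1ℚ; _+_; _*_; _-_)
  import Data.Rational.Properties as ℚₚ
  open import Data.List using (List; []; _∷_; _++_; map; length; replicate)
  open import Data.List.Relation.Unary.All using (All; []; _∷_)
  import Data.List.Relation.Unary.All.Properties as All
  open import Relation.Binary.PropositionalEquality
  import Data.Nat.Tactic.RingSolver as ℕ-Solver
  open import Tactic.RingSolver using (solve-∀)
  open RationalSums
  open BinomialWeights using (w)
  open BinomialTransform

  ⊕-pos-pos : ∀ p q → (+ suc p) ⊕ (+ suc q) ≡ + suc (p ℕ.+ suc q)
  ⊕-pos-pos p q = cong +_ (sum p q)
    where
    sum : ∀ p q → suc (q ℕ.+ 0) ℕ.+ suc (p ℕ.+ 0) ≡ suc (p ℕ.+ suc q)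
    sum = ℕ-Solver.solve-∀

  ⊕-pos-neg : ∀ p q → (+ suc p) ⊕ -[1+ q ] ≡ -[1+ p ℕ.+ suc q ]
  ⊕-pos-neg p q = cong -[1+_] (sum p q)
    where
    sum : ∀ p q → suc (q ℕ.+ 0 ℕ.+ (p ℕ.+ 0)) ≡ p ℕ.+ suc q
    sum = ℕ-Solver.solve-∀

  ⊕-neg-pos : ∀ p q → -[1+ p ] ⊕ (+ suc q) ≡ -[1+ p ℕ.+ suc q ]
  ⊕-neg-pos p q = cong -[1+_] (sum p q)
    where
    sum : ∀ p q → suc (q ℕ.+ 0 ℕ.+ (p ℕ.+ 0)) ≡ p ℕ.+ suc q
    sum = ℕ-Solver.solve-∀

  ⊕-neg-neg : ∀ p q → -[1+ p ] ⊕ -[1+ q ] ≡ + suc (p ℕ.+ suc q)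
  ⊕-neg-neg p q = cong +_ (sum p q)
    where
    sum : ∀ p q → suc (q ℕ.+ 0) ℕ.+ suc (p ℕ.+ 0) ≡ suc (p ℕ.+ suc q)
    sum = ℕ-Solver.solve-∀

  ⊕-nonZero : ∀ a b → NonZero a → NonZero b → NonZero (a ⊕ b)
  ⊕-nonZero (+ suc p) (+ suc q) _ _ = subst NonZero (sym (⊕-pos-pos p q)) _
  ⊕-nonZero (+ suc p) -[1+ q ]  _ _ = subst NonZero (sym (⊕-pos-neg p q)) _
  ⊕-nonZero -[1+ p ]  (+ suc q) _ _ = subst NonZero (sym (⊕-neg-pos p q)) _
  ⊕-nonZero -[1+ p ]  -[1+ q ]  _ _ = subst NonZero (sym (⊕-neg-neg p q)) _

  1/ℕ-^-+ : ∀ j m n → 1/ℕ (j ^ (m ℕ.+ n)) ≡ 1/ℕ (j ^ m) * 1/ℕ (j ^ n)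
  1/ℕ-^-+ j m n = trans (cong 1/ℕ (ℕₚ.^-distribˡ-+-* j m n)) (1/ℕ-* (j ^ m) (j ^ n))

  term-⊕ : ∀ a b → NonZero a → NonZero b → ∀ j → term j (a ⊕ b) ≡ term j a * term j b
  term-⊕ (+ suc p) (+ suc q) _ _ j = trans (cong (term j) (⊕-pos-pos p q))
    (trans (cong (1ℚ *_) (1/ℕ-^-+ j (suc p) (suc q))) (regroup (1/ℕ (j ^ suc p)) (1/ℕ (j ^ suc q))))
    where
    regroup : ∀ x y → 1ℚ * (x * y) ≡ (1ℚ * x) * (1ℚ * y)
    regroup = solve-∀ ℚ-ring
  term-⊕ (+ suc p) -[1+ q ] _ _ j = trans (cong (term j) (⊕-pos-neg p q))
    (trans (cong₂ _*_ (sgnPow-neg (p ℕ.+ suc q) j) (1/ℕ-^-+ j (suc p) (suc q)))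
    (trans (regroup (-1^ j) (1/ℕ (j ^ suc p)) (1/ℕ (j ^ suc q)))
      (cong (λ z → (1ℚ * 1/ℕ (j ^ suc p)) * (z * 1/ℕ (j ^ suc q))) (sym (sgnPow-neg q j)))))
    where
    regroup : ∀ s x y → s * (x * y) ≡ (1ℚ * x) * (s * y)
    regroup = solve-∀ ℚ-ring
  term-⊕ -[1+ p ] (+ suc q) _ _ j = trans (cong (term j) (⊕-neg-pos p q))
    (trans (cong₂ _*_ (sgnPow-neg (p ℕ.+ suc q) j) (1/ℕ-^-+ j (suc p) (suc q)))
    (trans (regroup (-1^ j) (1/ℕ (j ^ suc p)) (1/ℕ (j ^ suc q)))
      (cong (λ z → (z * 1/ℕ (j ^ suc p)) * (1ℚ * 1/ℕ (j ^ suc q))) (sym (sgnPow-neg p j)))))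
    where
    regroup : ∀ s x y → s * (x * y) ≡ (s * x) * (1ℚ * y)
    regroup = solve-∀ ℚ-ring
  term-⊕ -[1+ p ] -[1+ q ] _ _ j = trans (cong (term j) (⊕-neg-neg p q))
    (trans (cong (1ℚ *_) (1/ℕ-^-+ j (suc p) (suc q)))
    (trans (cong (_* (1/ℕ (j ^ suc p) * 1/ℕ (j ^ suc q))) (sym (-1^-square j)))
    (trans (regroup (-1^ j) (1/ℕ (j ^ suc p)) (1/ℕ (j ^ suc q)))
      (cong₂ (λ z z′ → (z * 1/ℕ (j ^ suc p)) * (z′ * 1/ℕ (j ^ suc q))) (sym (sgnPow-neg p j)) (sym (sgnPow-neg q j))))))
    where
    regroup : ∀ s x y → (s * s) * (x * y) ≡ (s * x) * (s * y)
    regroup = solve-∀ ℚ-ring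

  weight : List ℤ → ℚ
  weight p = ratio (2 ^ length p) 1

  U : ℤ → List ℤ → ℕ → ℚ
  U x xs k = sumℚ (map (λ p → weight p * H k p) (Πgo x xs))

  U-[] : ∀ x k → U x [] k ≡ ⟦ 2 ⟧ * H k (x ∷ [])
  U-[] x k = ℚₚ.+-identityʳ _

  sum-prefixed : ∀ k x (ps : List (List ℤ)) →
    sumℚ (map (λ p → weight p * H k p) (map (x ∷_) ps))
      ≡ sumTo k (λ j → term j x * (⟦ 2 ⟧ * sumℚ (map (λ p → weight p * H (j ∸ 1) p) ps)))
  sum-prefixed k x ps = begin
    sumℚ (map (λ p → weight p * H k p) (map (x ∷_) ps))
      ≡⟨ sumℚ-map-∘ (λ p → weight p * H k p) (x ∷_) ps ⟩
    sumℚ (map (λ p → weight (x ∷ p) * H k (x ∷ p)) ps)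
      ≡⟨ sumℚ-map-cong ps one ⟩
    sumℚ (map (λ p → sumTo k (λ j → term j x * (⟦ 2 ⟧ * (weight p * H (j ∸ 1) p)))) ps)
      ≡⟨ sumℚ-sumTo-comm k (λ p j → term j x * (⟦ 2 ⟧ * (weight p * H (j ∸ 1) p))) ps ⟩
    sumTo k (λ j → sumℚ (map (λ p → term j x * (⟦ 2 ⟧ * (weight p * H (j ∸ 1) p))) ps))
      ≡⟨ sumTo-cong k (λ j → trans (sumℚ-map-*ˡ (term (suc j) x) (λ p → ⟦ 2 ⟧ * (weight p * H j p)) ps)
                                   (cong (term (suc j) x *_) (sumℚ-map-*ˡ ⟦ 2 ⟧ (λ p → weight p * H j p) ps))) ⟩
    sumTo k (λ j → term j x * (⟦ 2 ⟧ * sumℚ (map (λ p → weight p * H (j ∸ 1) p) ps))) ∎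
    where
    open ≡-Reasoning
    regroup : ∀ a b t h → (a * b) * (t * h) ≡ t * (a * (b * h))
    regroup = solve-∀ ℚ-ring
    one : ∀ p → weight (x ∷ p) * H k (x ∷ p) ≡ sumTo k (λ j → term j x * (⟦ 2 ⟧ * (weight p * H (j ∸ 1) p)))
    one p = begin
      weight (x ∷ p) * H k (x ∷ p)
        ≡⟨ cong (_* H k (x ∷ p)) (⟦*⟧ 2 (2 ^ length p)) ⟩
      (⟦ 2 ⟧ * weight p) * sumTo k (λ j → term j x * H (j ∸ 1) p)
        ≡⟨ sym (sumTo-*ˡ k (⟦ 2 ⟧ * weight p) (λ j → term j x * H (j ∸ 1) p)) ⟩
      sumTo k (λ j → (⟦ 2 ⟧ * weight p) * (term j x * H (j ∸ 1) p))
        ≡⟨ sumTo-cong k (λ j → regroup ⟦ 2 ⟧ (weight p) (term (suc j) x) (H j p)) ⟩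
      sumTo k (λ j → term j x * (⟦ 2 ⟧ * (weight p * H (j ∸ 1) p))) ∎

  -- A component of p ∈ Π(x, y, ys) either is x itself (sum-prefixed) or begins with x ⊕ y.
  mutual
    U-∷ : ∀ k x y ys → NonZero x → NonZero y → All NonZero ys → U x (y ∷ ys) k ≡ Σ⁺ x (U y ys) k
    U-∷ k x y ys x≢0 y≢0 ys≢0 = begin
      U x (y ∷ ys) k
        ≡⟨ sumℚ-map-++ (λ p → weight p * H k p) (map (x ∷_) (Πgo y ys)) (Πgo (x ⊕ y) ys) ⟩
      sumℚ (map (λ p → weight p * H k p) (map (x ∷_) (Πgo y ys))) + U (x ⊕ y) ys k
        ≡⟨ cong₂ _+_ (sum-prefixed k x (Πgo y ys)) (U-⊕ k x y ys x≢0 y≢0 ys≢0) ⟩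
      sumTo k (λ j → term j x * (⟦ 2 ⟧ * U y ys (j ∸ 1))) + sumTo k (λ j → term j x * Δ (U y ys) j)
        ≡⟨ sym (sumTo-+ k (λ j → term j x * (⟦ 2 ⟧ * U y ys (j ∸ 1))) (λ j → term j x * Δ (U y ys) j)) ⟩
      sumTo k (λ j → term j x * (⟦ 2 ⟧ * U y ys (j ∸ 1)) + term j x * Δ (U y ys) j)
        ≡⟨ sumTo-cong k (λ j → combine (term (suc j) x) (U y ys (suc j)) (U y ys j)) ⟩
      Σ⁺ x (U y ys) k ∎
      where
      open ≡-Reasoning
      combine : ∀ t V₁ V₀ → t * ((1ℚ + 1ℚ) * V₀) + t * (V₁ - V₀) ≡ t * (V₁ + V₀)
      combine = solve-∀ ℚ-ring

    U-⊕ : ∀ k x y ys → NonZero x → NonZero y → All NonZero ys → U (x ⊕ y) ys k ≡ Σ⁻ x (U y ys) k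
    U-⊕ k x y [] x≢0 y≢0 _ = begin
      U (x ⊕ y) [] k                                 ≡⟨ U-[] (x ⊕ y) k ⟩
      ⟦ 2 ⟧ * sumTo k (λ j → term j (x ⊕ y) * 1ℚ)    ≡⟨ sym (sumTo-*ˡ k ⟦ 2 ⟧ (λ j → term j (x ⊕ y) * 1ℚ)) ⟩
      sumTo k (λ j → ⟦ 2 ⟧ * (term j (x ⊕ y) * 1ℚ))  ≡⟨ sumTo-cong k one ⟩
      Σ⁻ x (U y []) k                                ∎
      where
      open ≡-Reasoning
      regroup : ∀ c t₁ t₂ → c * ((t₁ * t₂) * 1ℚ) ≡ t₁ * (c * (t₂ * 1ℚ))
      regroup = solve-∀ ℚ-ring
      one : ∀ j → ⟦ 2 ⟧ * (term (suc j) (x ⊕ y) * 1ℚ) ≡ term (suc j) x * Δ (U y []) (suc j)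
      one j = trans (cong (λ t → ⟦ 2 ⟧ * (t * 1ℚ)) (term-⊕ x y x≢0 y≢0 (suc j)))
        (trans (regroup ⟦ 2 ⟧ (term (suc j) x) (term (suc j) y))
          (cong (term (suc j) x *_) (sym (trans (cong₂ _-_ (U-[] y (suc j)) (U-[] y j))
            (scaled-increment ⟦ 2 ⟧ (H j (y ∷ [])) (term (suc j) y * 1ℚ))))))
        where
        scaled-increment : ∀ c a b → c * (a + b) - c * a ≡ c * b
        scaled-increment = solve-∀ ℚ-ring
    U-⊕ k x y (z ∷ zs) x≢0 y≢0 (z≢0 ∷ zs≢0) = begin
      U (x ⊕ y) (z ∷ zs) k   ≡⟨ U-∷ k (x ⊕ y) z zs (⊕-nonZero x y x≢0 y≢0) z≢0 zs≢0 ⟩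
      Σ⁺ (x ⊕ y) V k         ≡⟨ sumTo-cong k one ⟩
      Σ⁻ x (U y (z ∷ zs)) k  ∎
      where
      open ≡-Reasoning
      V = U z zs
      one : ∀ j → term (suc j) (x ⊕ y) * Δ⁺ V (suc j) ≡ term (suc j) x * Δ (U y (z ∷ zs)) (suc j)
      one j = trans (cong (_* Δ⁺ V (suc j)) (term-⊕ x y x≢0 y≢0 (suc j)))
        (trans (ℚₚ.*-assoc (term (suc j) x) (term (suc j) y) (Δ⁺ V (suc j)))
          (cong (term (suc j) x *_) (sym (trans (cong₂ _-_ (U-∷ (suc j) y z zs y≢0 z≢0 zs≢0) (U-∷ j y z zs y≢0 z≢0 zs≢0))
            (sumTo-suc-∸ _ j)))))

  U-zero : ∀ x xs → NonZero x → All NonZero xs → U x xs 0 ≡ 0ℚ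
  U-zero x []       _   _            = trans (U-[] x 0) (ℚₚ.*-zeroʳ ⟦ 2 ⟧)
  U-zero x (y ∷ ys) x≢0 (y≢0 ∷ ys≢0) = U-∷ 0 x y ys x≢0 y≢0 ys≢0

  -- 𝓗_n(p) = Φ_n(k ↦ H_k(p)), as H_k(p) - H_{k-1}(p) is the k-th summand of 𝓗_n(p) without its weight w n k.
  weight*𝓗≡Φ : ∀ n p → weight p * 𝓗 n p ≡ Φ n (λ k → weight p * H k p)
  weight*𝓗≡Φ n [] = trans (ℚₚ.*-zeroʳ (weight [])) (sym (trans (sumTo-cong n (λ k → vanish (w n (suc k)) (weight []))) (sumTo-0 n)))
    where
    vanish : ∀ a c → a * (c * 1ℚ - c * 1ℚ) ≡ 0ℚ
    vanish = solve-∀ ℚ-ring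
  weight*𝓗≡Φ n (q ∷ qs) = trans (sym (sumTo-*ˡ n (weight (q ∷ qs)) _)) (sumTo-cong n λ k →
    increment (weight (q ∷ qs)) (term (suc k) q) (w n (suc k)) (H k qs) (H k (q ∷ qs)))
    where
    increment : ∀ c t ω h a → c * (t * ω * h) ≡ ω * (c * (a + t * h) - c * a)
    increment = solve-∀ ℚ-ring

  RHS≡Φ-U : ∀ n x xs → RHS n (x ∷ xs) ≡ Φ n (U x xs)
  RHS≡Φ-U n x xs = begin
    sumℚ (map (λ p → weight p * 𝓗 n p) ps)
      ≡⟨ sumℚ-map-cong ps (weight*𝓗≡Φ n) ⟩
    sumℚ (map (λ p → Φ n (λ k → weight p * H k p)) ps)
      ≡⟨ sumℚ-sumTo-comm n (λ p k → w n k * (weight p * H k p - weight p * H (k ∸ 1) p)) ps ⟩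
    sumTo n (λ k → sumℚ (map (λ p → w n k * (weight p * H k p - weight p * H (k ∸ 1) p)) ps))
      ≡⟨ sumTo-cong n (λ k → trans (sumℚ-map-*ˡ (w n (suc k)) _ ps)
           (cong (w n (suc k) *_) (sumℚ-map-- (λ p → weight p * H (suc k) p) (λ p → weight p * H k p) ps))) ⟩
    Φ n (U x xs) ∎
    where
    open ≡-Reasoning
    ps = Πgo x xs

  record Expansion (s t : List ℤ) : Set where
    field
      entries-nonZero : All NonZero t
      H⋆≡RHS          : ∀ n → H⋆ n s ≡ RHS n t

  expansion : ∀ {s x xs} → All NonZero (x ∷ xs) → (∀ n → H⋆ n s ≡ Φ n (U x xs)) → Expansion s (x ∷ xs)
  expansion {x = x} {xs} t≢0 H⋆≡Φ = record
    { entries-nonZero = t≢0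
    ; H⋆≡RHS = λ n → trans (H⋆≡Φ n) (sym (RHS≡Φ-U n x xs))
    }

  H⋆≡Φ-U : ∀ {s x xs} → Expansion s (x ∷ xs) → ∀ n → H⋆ n s ≡ Φ n (U x xs)
  H⋆≡Φ-U {x = x} {xs} e n = trans (Expansion.H⋆≡RHS e n) (RHS≡Φ-U n x xs)

  expansion-[1] : Expansion (+ 1 ∷ []) (+ 1 ∷ [])
  expansion-[1] = expansion (_ ∷ []) λ n →
    sym (trans (Φ-cong n (λ k → U-[] (+ 1) k)) (Φ-2H₁ n))

  expansion-1∷ : ∀ {s y T} → Expansion s (y ∷ T) → Expansion (+ 1 ∷ s) (+ 1 ∷ y ∷ T)
  expansion-1∷ {s} {y} {T} e with Expansion.entries-nonZero e
  ... | y≢0 ∷ T≢0 = expansion (_ ∷ y≢0 ∷ T≢0) λ n → begin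
    H⋆ n (+ 1 ∷ s)                              ≡⟨ sumTo-cong n (λ m → cong (term (suc m) (+ 1) *_) (H⋆≡Φ-U e (suc m))) ⟩
    sumTo n (λ m → term m (+ 1) * Φ m (U y T))  ≡⟨ sym (Φ-Σ⁺-1 (U y T) (U-zero y T y≢0 T≢0) n) ⟩
    Φ n (Σ⁺ (+ 1) (U y T))                      ≡⟨ Φ-cong n (λ k → sym (U-∷ k (+ 1) y T _ y≢0 T≢0)) ⟩
    Φ n (U (+ 1) (y ∷ T))                       ∎
    where open ≡-Reasoning

  expansion-2∷ : ∀ {s x xs} → Expansion s (x ∷ xs) → Expansion (+ 2 ∷ s) ((+ 2) ⊕ x ∷ xs)
  expansion-2∷ {s} {x} {xs} e with Expansion.entries-nonZero e
  ... | x≢0 ∷ xs≢0 = expansion (⊕-nonZero (+ 2) x _ x≢0 ∷ xs≢0) λ n → begin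
    H⋆ n (+ 2 ∷ s)                               ≡⟨ sumTo-cong n (λ m → cong (term (suc m) (+ 2) *_) (H⋆≡Φ-U e (suc m))) ⟩
    sumTo n (λ m → term m (+ 2) * Φ m (U x xs))  ≡⟨ sym (Φ-Σ⁻-2 (U x xs) n) ⟩
    Φ n (Σ⁻ (+ 2) (U x xs))                      ≡⟨ Φ-cong n (λ k → sym (U-⊕ k (+ 2) x xs _ x≢0 xs≢0)) ⟩
    Φ n (U ((+ 2) ⊕ x) xs)                       ∎
    where open ≡-Reasoning

  replicate-1-nonZero : ∀ m → All NonZero (replicate m (+ 1))
  replicate-1-nonZero zero    = []
  replicate-1-nonZero (suc m) = _ ∷ replicate-1-nonZero m

  U-1s : ∀ {y T} → NonZero y → All NonZero T → ∀ m x → NonZero x →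
    ∀ k → U x (replicate m (+ 1) ++ (-[1+ 0 ] ⊕ y) ∷ T) k ≡ Σ⁺ x (Ω (U y T) m) k
  U-1s {y} {T} y≢0 T≢0 zero x x≢0 k =
    trans (U-∷ k x (-[1+ 0 ] ⊕ y) T x≢0 (⊕-nonZero -[1+ 0 ] y _ y≢0) T≢0)
          (Σ⁺-cong x k (λ j → U-⊕ j -[1+ 0 ] y T _ y≢0 T≢0))
  U-1s {y} {T} y≢0 T≢0 (suc m) x x≢0 k =
    trans (U-∷ k x (+ 1) (replicate m (+ 1) ++ (-[1+ 0 ] ⊕ y) ∷ T) x≢0 _
                 (All.++⁺ (replicate-1-nonZero m) (⊕-nonZero -[1+ 0 ] y _ y≢0 ∷ T≢0)))
          (Σ⁺-cong x k (U-1s y≢0 T≢0 m (+ 1) _))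

  expansion-[3+m]∷ : ∀ {s y T} → Expansion s (y ∷ T) → ∀ m →
    Expansion (+ (3 ℕ.+ m) ∷ s) (-[1+ 1 ] ∷ replicate m (+ 1) ++ (-[1+ 0 ] ⊕ y) ∷ T)
  expansion-[3+m]∷ {s} {y} {T} e m with Expansion.entries-nonZero e
  ... | y≢0 ∷ T≢0 = expansion (_ ∷ All.++⁺ (replicate-1-nonZero m) (⊕-nonZero -[1+ 0 ] y _ y≢0 ∷ T≢0)) λ n → begin
    H⋆ n (+ (3 ℕ.+ m) ∷ s)
      ≡⟨ sumTo-cong n (λ j → cong (term (suc j) (+ (3 ℕ.+ m)) *_) (H⋆≡Φ-U e (suc j))) ⟩
    sumTo n (λ j → term j (+ (3 ℕ.+ m)) * Φ j (U y T))
      ≡⟨ sym (Φ-Σ⁺-[-2]-Ω (U y T) m n) ⟩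
    Φ n (Σ⁺ -[1+ 1 ] (Ω (U y T) m))
      ≡⟨ Φ-cong n (λ k → sym (U-1s y≢0 T≢0 m -[1+ 1 ] _ k)) ⟩
    Φ n (U -[1+ 1 ] (replicate m (+ 1) ++ (-[1+ 0 ] ⊕ y) ∷ T)) ∎
    where open ≡-Reasoning

  2⊕[2a+1] : ∀ a → (+ 2) ⊕ (+ (2 ℕ.* a ℕ.+ 1)) ≡ + (2 ℕ.* suc a ℕ.+ 1)
  2⊕[2a+1] a = trans (cong (λ z → (+ 2) ⊕ (+ z)) (ℕₚ.+-comm (2 ℕ.* a) 1))
    (trans (⊕-pos-pos 1 (2 ℕ.* a)) (cong +_ (sum a)))
    where
    sum : ∀ a → suc (1 ℕ.+ suc (2 ℕ.* a)) ≡ 2 ℕ.* suc a ℕ.+ 1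
    sum = ℕ-Solver.solve-∀

  2⊕-[2b+2] : ∀ b → (+ 2) ⊕ (ℤ.- (+ (2 ℕ.* b ℕ.+ 2))) ≡ ℤ.- (+ (2 ℕ.* suc b ℕ.+ 2))
  2⊕-[2b+2] b = trans (cong (λ z → (+ 2) ⊕ (ℤ.- (+ z))) (ℕₚ.+-suc (2 ℕ.* b) 1))
    (trans (⊕-pos-neg 1 (2 ℕ.* b ℕ.+ 1))
      (trans (cong -[1+_] (sum b)) (cong (λ z → ℤ.- (+ z)) (sym (ℕₚ.+-suc (2 ℕ.* suc b) 1)))))
    where
    sum : ∀ b → 1 ℕ.+ suc (2 ℕ.* b ℕ.+ 1) ≡ 2 ℕ.* suc b ℕ.+ 1
    sum = ℕ-Solver.solve-∀

  -1⊕[2a+1] : ∀ a → -[1+ 0 ] ⊕ (+ (2 ℕ.* a ℕ.+ 1)) ≡ ℤ.- (+ (2 ℕ.* a ℕ.+ 2))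
  -1⊕[2a+1] a = trans (cong (λ z → -[1+ 0 ] ⊕ (+ z)) (ℕₚ.+-comm (2 ℕ.* a) 1))
    (trans (⊕-neg-pos 0 (2 ℕ.* a))
      (trans (cong -[1+_] (ℕₚ.+-comm 1 (2 ℕ.* a))) (cong (λ z → ℤ.- (+ z)) (sym (ℕₚ.+-suc (2 ℕ.* a) 1)))))

  Extendable : List ℤ → List ℤ → Set
  Extendable sT tT = ∀ a → Expansion (replicate a (+ 2) ++ (+ 1) ∷ sT) (+ (2 ℕ.* a ℕ.+ 1) ∷ tT)

  extendable : ∀ {sT tT} → Expansion (+ 1 ∷ sT) (+ 1 ∷ tT) → Extendable sT tT
  extendable e zero    = e
  extendable {sT} {tT} e (suc a) =
    subst (λ x → Expansion (replicate (suc a) (+ 2) ++ (+ 1) ∷ sT) (x ∷ tT)) (2⊕[2a+1] a) (expansion-2∷ (extendable e a))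

  expansion-2s : ∀ {s T} → Expansion s (-[1+ 1 ] ∷ T) → ∀ b → Expansion (replicate b (+ 2) ++ s) (ℤ.- (+ (2 ℕ.* b ℕ.+ 2)) ∷ T)
  expansion-2s e zero    = e
  expansion-2s {s} {T} e (suc b) =
    subst (λ x → Expansion (replicate (suc b) (+ 2) ++ s) (x ∷ T)) (2⊕-[2b+2] b) (expansion-2∷ (expansion-2s e b))

  extendable-[] : Extendable [] []
  extendable-[] = extendable expansion-[1]

open import Data.Nat using (ℕ; suc; _≤_; _+_; _*_)
open import Data.Integer using (+_)
open import Data.List using (_∷_; _++_; replicate)
open import Data.Product using (_×_; _,_)
open import Relation.Binary.PropositionalEquality using (_≡_)
open Expansions using (Expansion)

module Blocks (a b c : ℕ → ℕ) (c≥3 : ∀ j → 1 ≤ j → 3 ≤ c j) where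

  open import Data.Nat using (zero; suc; _∸_; s≤s; z≤n)
  open import Data.Nat.Properties using (m+[n∸m]≡n)
  open import Data.Integer as ℤ using (ℤ; -[1+_])
  open import Data.List using (List; [])
  open import Data.List.Properties using (++-assoc; ++-identityʳ)
  open import Relation.Binary.PropositionalEquality using (cong; sym; trans; subst₂)
  open Expansions

  sB pB : ℕ → List ℤ
  sB = sBlock a b c
  pB = pBlock a b c

  expansion-block : ∀ j → 1 ≤ j → ∀ {sT tT} → Extendable sT tT → Expansion (sB j ++ sT) (pB j ++ tT)
  expansion-block j j≥1 {sT} {tT} ext =
    subst₂ Expansion s-assoc t-assoc (expansion-2s (expansion-[3+m]∷ (ext (a j)) m) (b j))
    where
    m = c j ∸ 3
    s-assoc : replicate (b j) (+ 2) ++ (+ (3 + m)) ∷ replicate (a j) (+ 2) ++ (+ 1) ∷ sT ≡ sB j ++ sT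
    s-assoc = trans (cong (λ z → replicate (b j) (+ 2) ++ (+ z) ∷ replicate (a j) (+ 2) ++ (+ 1) ∷ sT) (m+[n∸m]≡n (c≥3 j j≥1)))
      (trans (cong (λ z → replicate (b j) (+ 2) ++ (+ c j) ∷ z) (sym (++-assoc (replicate (a j) (+ 2)) ((+ 1) ∷ []) sT)))
        (sym (++-assoc (replicate (b j) (+ 2)) ((+ c j) ∷ replicate (a j) (+ 2) ++ (+ 1) ∷ []) sT)))
    t-assoc : ℤ.- (+ (2 * b j + 2)) ∷ replicate m (+ 1) ++ (-[1+ 0 ] ⊕ (+ (2 * a j + 1))) ∷ tT ≡ pB j ++ tT
    t-assoc = cong (ℤ.- (+ (2 * b j + 2)) ∷_) (trans (cong (λ z → replicate m (+ 1) ++ z ∷ tT) (-1⊕[2a+1] (a j)))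
      (sym (++-assoc (replicate m (+ 1)) (ℤ.- (+ (2 * a j + 2)) ∷ []) tT)))

  extendable-block : ∀ j → 1 ≤ j → ∀ {sT tT} → Extendable sT tT → Extendable (sB j ++ sT) (pB j ++ tT)
  extendable-block j j≥1 ext = extendable (expansion-1∷ (expansion-block j j≥1 ext))

  extendable-blocks : ∀ r {sT tT} → Extendable sT tT → Extendable (concatUpTo sB r ++ sT) (concatUpTo pB r ++ tT)
  extendable-blocks zero    ext = ext
  extendable-blocks (suc r) {sT} {tT} ext =
    subst₂ Extendable (sym (++-assoc (concatUpTo sB r) (sB (suc r)) sT)) (sym (++-assoc (concatUpTo pB r) (pB (suc r)) tT))
      (extendable-blocks r (extendable-block (suc r) (s≤s z≤n) ext))

  expansion-blocks : ∀ r {sT tT} → Extendable sT tT → Expansion (concatUpTo sB (suc r) ++ sT) (concatUpTo pB (suc r) ++ tT)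
  expansion-blocks zero    ext = expansion-block 1 (s≤s z≤n) ext
  expansion-blocks (suc r) {sT} {tT} ext =
    subst₂ Expansion (sym (++-assoc (concatUpTo sB (suc r)) (sB (suc (suc r))) sT))
                     (sym (++-assoc (concatUpTo pB (suc r)) (pB (suc (suc r))) tT))
      (expansion-blocks r (extendable-block (suc (suc r)) (s≤s z≤n) ext))

  expansion-part-i : ∀ r → Expansion (concatUpTo sB (suc r)) (concatUpTo pB (suc r))
  expansion-part-i r = subst₂ Expansion (++-identityʳ _) (++-identityʳ _) (expansion-blocks r extendable-[])

  extendable-part-ii : ∀ r → Extendable (concatUpTo sB r) (concatUpTo pB r)
  extendable-part-ii r = subst₂ Extendable (++-identityʳ _) (++-identityʳ _) (extendable-blocks r extendable-[])

theorem5p1 : (a b c : ℕ → ℕ) → (∀ j → 1 ≤ j → 3 ≤ c j) → (n : ℕ) → 1 ≤ n →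
    ((r : ℕ) → 1 ≤ r →
       H⋆ n (concatUpTo (sBlock a b c) r) ≡ RHS n (concatUpTo (pBlock a b c) r))
  × ((r : ℕ) →
       H⋆ n (replicate (a 0) (+ 2) ++ (+ 1) ∷ concatUpTo (sBlock a b c) r)
         ≡ RHS n ((+ (2 * a 0 + 1)) ∷ concatUpTo (pBlock a b c) r))
theorem5p1 a b c c≥3 n _ =
    (λ { (suc r) _ → Expansion.H⋆≡RHS (expansion-part-i r) n })
  , (λ r → Expansion.H⋆≡RHS (extendable-part-ii r (a 0)) n)
  where open Blocks a b c c≥3
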